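{- Let $N$ be a finite set with $|N|\ge2$ and $m\in\mathbb{R}^{\mathcal{P}(N)}$. Then $m\in T(N)$ if and only if $\langle\theta,m\rangle\ge0$ for every $\theta\in\Delta$.
   Context: $\langle\theta,m\rangle=\sum_{S\subseteq N}\theta(S)m(S)$. For $M\subseteq N$ with $|M|\ge2$, $\Delta_M$ is the set of $\theta\in\mathbb{R}^{\mathcal{P}(N)}$ with $\theta(S)\le0$ for $\emptyset\ne S\subsetneq M$, $\theta(R)=0$ for all $R\subseteq N$ with $R\setminus M\ne\emptyset$, $\theta(\emptyset)=1$, $\sum_{S\subseteq N}\theta(S)=0$, and $\sum_{T\subseteq N:\,i\in T}\theta(T)=0$ for each $i\in N$ (a polytope). $\Delta$ is the convex hull of $\bigcup_{M\subseteq N,|M|\ge2}\Delta_M$. For $m\in\mathbb{R}^{\mathcal{P}(N)}$ let $\tilde m(S)=m(S)-m(\emptyset)$. The core of a game $g$ ($g(\emptyset)=0$) over a player set $A$ is $\{x\in\mathbb{R}^A:\sum_{i\in A}x_i=g(A),\ \sum_{i\in S}x_i\ge g(S)\ \forall S\subseteq A\}$. $T(N)$ is the set of $m$ such that for every non-empty $A\subseteq N$ the restriction of $\tilde m$ to $\mathcal{P}(A)$ has non-empty core. -}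

module Defs where

open import Level using (Level; _⊔_) renaming (suc to lsuc; zero to lzero)
open import Data.Nat using (ℕ; zero; suc; _≤_)
open import Data.Bool using (Bool; true; false; if_then_else_)
open import Data.Fin using (Fin)
open import Data.Fin.Subset using (Subset; _⊆_; _∈_; ⊥; ∣_∣; _⊂_; Nonempty) renaming (⊤ to full)
open import Data.Vec using (Vec; []; _∷_; lookup)
open import Data.Product using (Σ; _×_; _,_; ∃; ∃-syntax)
open import Relation.Binary.PropositionalEquality using (_≡_; _≢_)
open import Relation.Nullary using (¬_)
import Data.Sum
import Data.Fin as Fin

-- The real numbers, given axiomatically as a complete ordered field.
-- (Any two such structures are isomorphic, so quantifying over all of
-- them is the same as speaking about ℝ.)

record RealField : Set₁ where
  infixl 6 _+_
  infixl 7 _*_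
  infix  4 _≤ℝ_
  field
    ℝ     : Set
    0ℝ 1ℝ : ℝ
    _+_ _*_ : ℝ → ℝ → ℝ
    -_    : ℝ → ℝ
    _≤ℝ_  : ℝ → ℝ → Set
    +-assoc : ∀ x y z → (x + y) + z ≡ x + (y + z)
    +-comm  : ∀ x y → x + y ≡ y + x
    +-idʳ   : ∀ x → x + 0ℝ ≡ x
    +-invʳ  : ∀ x → x + (- x) ≡ 0ℝ
    *-assoc : ∀ x y z → (x * y) * z ≡ x * (y * z)
    *-comm  : ∀ x y → x * y ≡ y * x
    *-idʳ   : ∀ x → x * 1ℝ ≡ x
    *-invʳ  : ∀ x → x ≢ 0ℝ → ∃[ y ] (x * y ≡ 1ℝ)
    distribˡ : ∀ x y z → x * (y + z) ≡ x * y + x * z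
    0≢1     : 0ℝ ≢ 1ℝ
    ≤-refl    : ∀ x → x ≤ℝ x
    ≤-trans   : ∀ {x y z} → x ≤ℝ y → y ≤ℝ z → x ≤ℝ z
    ≤-antisym : ∀ {x y} → x ≤ℝ y → y ≤ℝ x → x ≡ y
    ≤-total   : ∀ x y → (x ≤ℝ y) Data.Sum.⊎ (y ≤ℝ x)
    +-mono    : ∀ {x y} z → x ≤ℝ y → x + z ≤ℝ y + z
    *-nonneg  : ∀ {x y} → 0ℝ ≤ℝ x → 0ℝ ≤ℝ y → 0ℝ ≤ℝ x * y
    complete  : (P : ℝ → Set) → ∃[ a ] P a → ∃[ b ] (∀ x → P x → x ≤ℝ b) →
                ∃[ s ] ((∀ x → P x → x ≤ℝ s) ×
                        (∀ b → (∀ x → P x → x ≤ℝ b) → s ≤ℝ b))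

module _ (R : RealField) where
  open RealField R

  sumFin : (n : ℕ) → (Fin n → ℝ) → ℝ
  sumFin zero    f = 0ℝ
  sumFin (suc n) f = f Fin.zero + sumFin n (λ i → f (Fin.suc i))

  sumIn : {n : ℕ} → Subset n → (Fin n → ℝ) → ℝ
  sumIn {n} S x = sumFin n (λ i → if lookup S i then x i else 0ℝ)

  sumSub : (n : ℕ) → (Subset n → ℝ) → ℝ
  sumSub zero    f = f []
  sumSub (suc n) f = sumSub n (λ s → f (false ∷ s)) + sumSub n (λ s → f (true ∷ s))

  sumSubWith : {n : ℕ} → Fin n → (Subset n → ℝ) → ℝ
  sumSubWith {n} i f = sumSub n (λ T → if lookup T i then f T else 0ℝ)

  ⟨_,_⟩ : {n : ℕ} → (Subset n → ℝ) → (Subset n → ℝ) → ℝ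
  ⟨_,_⟩ {n} θ m = sumSub n (λ S → θ S * m S)

  InΔM : {n : ℕ} → Subset n → (Subset n → ℝ) → Set
  InΔM {n} M θ =
      (∀ S → Nonempty S → S ⊂ M → θ S ≤ℝ 0ℝ)
    × (∀ R → ¬ (R ⊆ M) → θ R ≡ 0ℝ)
    × (θ ⊥ ≡ 1ℝ)
    × (sumSub n θ ≡ 0ℝ)
    × (∀ i → sumSubWith i θ ≡ 0ℝ)

  InΔ : {n : ℕ} → (Subset n → ℝ) → Set
  InΔ {n} θ =
    ∃[ k ] Σ (Fin k → ℝ) λ w → Σ (Fin k → Subset n) λ M → Σ (Fin k → (Subset n → ℝ)) λ p →
        (∀ j → 0ℝ ≤ℝ w j)
      × (sumFin k w ≡ 1ℝ)
      × (∀ j → 2 ≤ ∣ M j ∣)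
      × (∀ j → InΔM (M j) (p j))
      × (∀ S → θ S ≡ sumFin k (λ j → w j * p j S))

  tilde : {n : ℕ} → (Subset n → ℝ) → Subset n → ℝ
  tilde m S = m S + (- m ⊥)

  -- core of the game g restricted to P(A) is non-empty
  -- (x ∈ ℝ^A represented by x : Fin n → ℝ, only coordinates in A used)
  CoreNonempty : {n : ℕ} → (Subset n → ℝ) → Subset n → Set
  CoreNonempty {n} g A = ∃[ x ]
      (sumIn A x ≡ g A) × (∀ S → S ⊆ A → g S ≤ℝ sumIn S x)

  InT : {n : ℕ} → (Subset n → ℝ) → Set
  InT {n} m = ∀ A → Nonempty A → CoreNonempty (tilde m) A

module Submission where

-- Forward direction: if x lies in the core of m̃ on M and θ ∈ Δ_M, then
-- ⟨θ, m⟩ = ⟨θ, m̃⟩ ≥ ⟨θ, x(·)⟩ = Σᵢ xᵢ Σ_{T ∋ i} θ(T) = 0, because θ is non-positive exactly on the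
-- proper coalitions, where x(S) ≥ m̃(S) may be strict; the inequality survives convex combinations.
--
-- Backward direction: non-emptiness of the core of m̃ on A is the feasibility of a finite system of
-- linear inequalities with integer coefficients. Fourier–Motzkin elimination shows that such a system
-- is feasible unless a non-negative integer combination μ·[x(A) ≤ m̃(A)] + Σ_S β(S)·[−x(S) ≤ −m̃(S)]
-- has zero coefficients, i.e. Σ_{S ∋ i} β(S) = μ·1_A(i), and a negative right-hand side. If β lives on
-- ∅ and A only, that right-hand side is 0. Otherwise θ = c·δ_∅ + μ·δ_A − β, with c making θ sum to
-- zero and scaled so that θ(∅) = 1, lies in Δ_A, and ⟨θ, m⟩ is a positive multiple of the right-hand
-- side.

open import Defs
open import Level using (0ℓ)
open import Algebra.Bundles using (CommutativeRing)
open import Algebra.Consequences.Propositional using (comm∧idʳ⇒id; comm∧invʳ⇒inv; comm∧distrˡ⇒distrʳ)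
open import Data.Bool as Bool using (true; false; if_then_else_)
open import Data.Empty using (⊥-elim)
open import Data.Fin using (Fin; zero; suc)
open import Data.Fin.Subset using (Subset; _⊆_; _⊂_; _∈_; _∉_; Nonempty; ∣_∣; ⊥; ⁅_⁆)
open import Data.Fin.Subset.Properties using (_⊆?_; _⊂?_; _∈?_; ⊆-antisym; ⊂-irref; ∉⊥; nonempty?; Empty-unique; ∣⊥∣≡0; ∣⁅x⁆∣≡1; x∈⁅y⁆⇒x≡y; p⊆q⇒∣p∣≤∣q∣; p⊂q⇒∣p∣<∣q∣; ⊥⊆)
open import Data.Vec using ([]; _∷_; lookup)
import Data.Vec.Properties as Vec
import Data.List.Relation.Unary.All.Properties as All
open import Data.List.Membership.Propositional using () renaming (_∈_ to _∈ₗ_)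
import Data.Vec.Functional as Vecᶠ
open import Function using (_∘_; case_of_)
open import Relation.Binary.Definitions using (DecidableEquality)
open import Data.Integer as ℤ using (ℤ; -[1+_]; +0; +[1+_])
import Data.Integer.Properties as ℤ
open import Data.Nat as ℕ using (ℕ; zero; suc; _≤_)
import Data.Nat.Properties as ℕ
open import Data.Product using (_,_; _×_; proj₁; proj₂; ∃-syntax)
open import Function.Bundles using (_⇔_; mk⇔)
open import Data.List using (List; []; _∷_; _++_; concatMap; map; filter)
open import Data.List.Relation.Unary.Any using (here)
open import Data.List.Membership.Propositional.Properties using (∈-++⁺ˡ; ∈-++⁺ʳ; ∈-map⁺; ∈-filter⁺)
open import Data.List.Relation.Unary.All as All using (All; []; _∷_)
open import Data.Sign as Sign using (Sign)
open import Data.Sum using (inj₁; inj₂)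
open import Relation.Binary.Bundles using (Poset)
import Relation.Binary.Reasoning.PartialOrder
open import Relation.Binary.PropositionalEquality using (_≡_; _≢_; refl; sym; trans; cong; cong₂; subst; subst₂; isEquivalence; module ≡-Reasoning)
open import Relation.Nullary using (¬_; does; yes; no)
open import Relation.Nullary.Decidable using (dec-true; dec-false)
open import Algebra.Solver.Ring.AlmostCommutativeRing using (AlmostCommutativeRing; fromCommutativeRing; _-Raw-AlmostCommutative⟶_)
import Algebra.Solver.Ring
import Data.Maybe as Maybe
open import Relation.Nullary.Decidable using (dec⇒maybe)

_≟ₛ_ : ∀ {n} → DecidableEquality (Subset n)
_≟ₛ_ = Vec.≡-dec Bool._≟_

⊆∧⊄⇒≡ : ∀ {n} {S M : Subset n} → S ⊆ M → ¬ S ⊂ M → S ≡ M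
⊆∧⊄⇒≡ {S = S} {M} S⊆M S⊄M = ⊆-antisym S⊆M M⊆S
  where
    M⊆S : M ⊆ S
    M⊆S {x} x∈M with x ∈? S
    ... | yes x∈S = x∈S
    ... | no  x∉S = ⊥-elim (S⊄M (S⊆M , x , x∈M , x∉S))

nonempty⇒≢⊥ : ∀ {n} {S : Subset n} → Nonempty S → S ≢ ⊥
nonempty⇒≢⊥ (x , x∈S) refl = ∉⊥ x∈S

≢⊥⇒nonempty : ∀ {n} {S : Subset n} → S ≢ ⊥ → Nonempty S
≢⊥⇒nonempty {S = S} S≢⊥ with nonempty? S
... | yes S-nonempty = S-nonempty
... | no  S-empty    = ⊥-elim (S≢⊥ (Empty-unique S-empty))

nonempty⇒1≤∣S∣ : ∀ {n} {S : Subset n} → Nonempty S → 1 ≤ ∣ S ∣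
nonempty⇒1≤∣S∣ {S = S} (x , x∈S) = subst (_≤ ∣ S ∣) (∣⁅x⁆∣≡1 x) (p⊆q⇒∣p∣≤∣q∣ ⁅x⁆⊆S)
  where ⁅x⁆⊆S : ⁅ x ⁆ ⊆ S
        ⁅x⁆⊆S y∈⁅x⁆ = subst (_∈ S) (sym (x∈⁅y⁆⇒x≡y x y∈⁅x⁆)) x∈S

2≤∣S∣⇒nonempty : ∀ {n} {S : Subset n} → 2 ≤ ∣ S ∣ → Nonempty S
2≤∣S∣⇒nonempty {n} {S} 2≤∣S∣ = ≢⊥⇒nonempty λ { refl → case subst (2 ≤_) (∣⊥∣≡0 n) 2≤∣S∣ of λ () }

lookup-⊥ : ∀ {n} (i : Fin n) → lookup ⊥ i ≡ false
lookup-⊥ i = Vec.lookup-replicate i false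

subsets : ∀ n → List (Subset n)
subsets zero    = [] ∷ []
subsets (suc n) = map (false ∷_) (subsets n) ++ map (true ∷_) (subsets n)

∈-subsets : ∀ {n} (S : Subset n) → S ∈ₗ subsets n
∈-subsets []                  = here refl
∈-subsets {suc n} (false ∷ S) = ∈-++⁺ˡ (∈-map⁺ (false ∷_) (∈-subsets S))
∈-subsets {suc n} (true ∷ S)  = ∈-++⁺ʳ (map (false ∷_) (subsets n)) (∈-map⁺ (true ∷_) (∈-subsets S))

sumSubℕ : ∀ n → (Subset n → ℕ) → ℕ
sumSubℕ zero    f = f []
sumSubℕ (suc n) f = sumSubℕ n (f ∘ (false ∷_)) ℕ.+ sumSubℕ n (f ∘ (true ∷_))

module OrderedField (R : RealField) where
  open RealField R

  commutativeRing : CommutativeRing 0ℓ 0ℓ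
  commutativeRing = record
    { isCommutativeRing = record
      { isRing = record
        { +-isAbelianGroup = record
          { isGroup = record
            { isMonoid = record
              { isSemigroup = record
                { isMagma = record { isEquivalence = isEquivalence ; ∙-cong = cong₂ _+_ }
                ; assoc = +-assoc }
              ; identity = comm∧idʳ⇒id +-comm +-idʳ }
            ; inverse = comm∧invʳ⇒inv +-comm +-invʳ
            ; ⁻¹-cong = cong -_ }
          ; comm = +-comm }
        ; *-cong = cong₂ _*_
        ; *-assoc = *-assoc
        ; *-identity = comm∧idʳ⇒id *-comm *-idʳ
        ; distrib = distribˡ , comm∧distrˡ⇒distrʳ *-comm distribˡ }
      ; *-comm = *-comm } }

  open CommutativeRing commutativeRing public
    using (ring; semiring; +-identityˡ; *-identityˡ; -‿inverseˡ; distribʳ; zeroˡ; zeroʳ)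
  open import Algebra.Properties.Ring ring public
    using (-‿involutive; -0#≈0#; -‿distribˡ-*; -‿distribʳ-*; -‿+-comm; xyx⁻¹≈y)

  open import Algebra.Properties.Semiring.Mult semiring using (×-homo-+; ×1-homo-*) renaming (_×_ to _×ℝ_)

  fromℕ : ℕ → ℝ
  fromℕ n = n ×ℝ 1ℝ

  fromℕ-+ : ∀ m n → fromℕ (m ℕ.+ n) ≡ fromℕ m + fromℕ n
  fromℕ-+ = ×-homo-+ 1ℝ

  fromℕ-* : ∀ m n → fromℕ (m ℕ.* n) ≡ fromℕ m * fromℕ n
  fromℕ-* = ×1-homo-*

  fromℕ-1 : fromℕ 1 ≡ 1ℝ
  fromℕ-1 = +-idʳ 1ℝ

  fromℤ : ℤ → ℝ
  fromℤ (ℤ.+ n)    = fromℕ n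
  fromℤ -[1+ n ] = - fromℕ (suc n)

  fromℤ-neg : ∀ i → fromℤ (ℤ.- i) ≡ - fromℤ i
  fromℤ-neg +0        = sym -0#≈0#
  fromℤ-neg +[1+ n ] = refl
  fromℤ-neg -[1+ n ] = sym (-‿involutive _)

  fromℤ-⊖ : ∀ m n → fromℤ (m ℤ.⊖ n) ≡ fromℕ m + - fromℕ n
  fromℤ-⊖ m       zero    = sym (trans (cong (fromℕ m +_) -0#≈0#) (+-idʳ _))
  fromℤ-⊖ zero    (suc n) = sym (+-identityˡ _)
  fromℤ-⊖ (suc m) (suc n) = begin
    fromℤ (suc m ℤ.⊖ suc n)                  ≡⟨ cong fromℤ (ℤ.[1+m]⊖[1+n]≡m⊖n m n) ⟩
    fromℤ (m ℤ.⊖ n)                          ≡⟨ fromℤ-⊖ m n ⟩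
    fromℕ m + - fromℕ n                      ≡⟨ cong (_+ - fromℕ n) (sym (xyx⁻¹≈y 1ℝ (fromℕ m))) ⟩
    (1ℝ + fromℕ m) + - 1ℝ + - fromℕ n        ≡⟨ +-assoc _ _ _ ⟩
    (1ℝ + fromℕ m) + (- 1ℝ + - fromℕ n)      ≡⟨ cong ((1ℝ + fromℕ m) +_) (-‿+-comm 1ℝ (fromℕ n)) ⟩
    (1ℝ + fromℕ m) + - (1ℝ + fromℕ n)        ∎
    where open ≡-Reasoning

  fromℤ-+ : ∀ i j → fromℤ (i ℤ.+ j) ≡ fromℤ i + fromℤ j
  fromℤ-+ -[1+ m ] -[1+ n ] = begin
    - (1ℝ + fromℕ (suc m ℕ.+ n))          ≡⟨ cong (λ t → - (1ℝ + t)) (fromℕ-+ (suc m) n) ⟩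
    - (1ℝ + (fromℕ (suc m) + fromℕ n))    ≡⟨ cong -_ (+-comm 1ℝ _) ⟩
    - ((fromℕ (suc m) + fromℕ n) + 1ℝ)    ≡⟨ cong -_ (+-assoc _ _ _) ⟩
    - (fromℕ (suc m) + (fromℕ n + 1ℝ))    ≡⟨ cong (λ t → - (fromℕ (suc m) + t)) (+-comm (fromℕ n) 1ℝ) ⟩
    - (fromℕ (suc m) + fromℕ (suc n))     ≡⟨ -‿+-comm _ _ ⟨
    - fromℕ (suc m) + - fromℕ (suc n)     ∎
    where open ≡-Reasoning
  fromℤ-+ -[1+ m ] (ℤ.+ n)  = trans (fromℤ-⊖ n (suc m)) (+-comm _ _)
  fromℤ-+ (ℤ.+ m)  -[1+ n ] = fromℤ-⊖ m (suc n)
  fromℤ-+ (ℤ.+ m)  (ℤ.+ n)  = fromℕ-+ m n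

  private
    signed : Sign → ℝ → ℝ
    signed Sign.+ x = x
    signed Sign.- x = - x

    fromℤ-◃ : ∀ s n → fromℤ (s ℤ.◃ n) ≡ signed s (fromℕ n)
    fromℤ-◃ Sign.+ n = cong fromℤ (ℤ.+◃n≡+n n)
    fromℤ-◃ Sign.- n = trans (cong fromℤ (ℤ.-◃n≡-n n)) (fromℤ-neg (ℤ.+ n))

    signed-* : ∀ s t a b → signed (s Sign.* t) (a * b) ≡ signed s a * signed t b
    signed-* Sign.+ Sign.+ a b = refl
    signed-* Sign.+ Sign.- a b = -‿distribʳ-* a b
    signed-* Sign.- Sign.+ a b = -‿distribˡ-* a b
    signed-* Sign.- Sign.- a b = trans (sym (-‿involutive _)) (trans (cong -_ (-‿distribʳ-* a b)) (-‿distribˡ-* a (- b)))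

    fromℤ-signed : ∀ i → fromℤ i ≡ signed (ℤ.sign i) (fromℕ ℤ.∣ i ∣)
    fromℤ-signed i = trans (cong fromℤ (sym (ℤ.◃-inverse i))) (fromℤ-◃ (ℤ.sign i) ℤ.∣ i ∣)

  fromℤ-* : ∀ i j → fromℤ (i ℤ.* j) ≡ fromℤ i * fromℤ j
  fromℤ-* i j = begin
    fromℤ (ℤ.sign i Sign.* ℤ.sign j ℤ.◃ ℤ.∣ i ∣ ℕ.* ℤ.∣ j ∣)
      ≡⟨ fromℤ-◃ (ℤ.sign i Sign.* ℤ.sign j) (ℤ.∣ i ∣ ℕ.* ℤ.∣ j ∣) ⟩
    signed (ℤ.sign i Sign.* ℤ.sign j) (fromℕ (ℤ.∣ i ∣ ℕ.* ℤ.∣ j ∣))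
      ≡⟨ cong (signed (ℤ.sign i Sign.* ℤ.sign j)) (fromℕ-* ℤ.∣ i ∣ ℤ.∣ j ∣) ⟩
    signed (ℤ.sign i Sign.* ℤ.sign j) (fromℕ ℤ.∣ i ∣ * fromℕ ℤ.∣ j ∣)
      ≡⟨ signed-* (ℤ.sign i) (ℤ.sign j) _ _ ⟩
    signed (ℤ.sign i) (fromℕ ℤ.∣ i ∣) * signed (ℤ.sign j) (fromℕ ℤ.∣ j ∣)
      ≡⟨ cong₂ _*_ (fromℤ-signed i) (fromℤ-signed j) ⟨
    fromℤ i * fromℤ j ∎
    where open ≡-Reasoning

  almostCommutativeRing : AlmostCommutativeRing 0ℓ 0ℓ
  almostCommutativeRing = fromCommutativeRing commutativeRing

  fromℤ-morphism : ℤ.+-*-rawRing -Raw-AlmostCommutative⟶ almostCommutativeRing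
  fromℤ-morphism = record
    { ⟦_⟧ = fromℤ ; +-homo = fromℤ-+ ; *-homo = fromℤ-* ; -‿homo = fromℤ-neg
    ; 0-homo = refl ; 1-homo = fromℕ-1 }

  -- Integer coefficients make the solver's normal forms comparable by computation.
  module RingSolver = Algebra.Solver.Ring ℤ.+-*-rawRing almostCommutativeRing fromℤ-morphism
    (λ i j → Maybe.map (cong fromℤ) (dec⇒maybe (i ℤ.≟ j)))
  open RingSolver public using (solve; _:=_; _:+_; _:*_; _:-_; :-_; con)

  ≤-poset : Poset 0ℓ 0ℓ 0ℓ
  ≤-poset = record
    { isPartialOrder = record
      { isPreorder = record
        { isEquivalence = isEquivalence
        ; reflexive = λ { refl → ≤-refl _ }
        ; trans = ≤-trans }
      ; antisym = ≤-antisym } }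

  module ≤-Reasoning = Relation.Binary.Reasoning.PartialOrder ≤-poset

  ≤-reflexive : ∀ {x y} → x ≡ y → x ≤ℝ y
  ≤-reflexive refl = ≤-refl _

  +-monoʳ-≤ : ∀ z {x y} → x ≤ℝ y → z + x ≤ℝ z + y
  +-monoʳ-≤ z {x} {y} x≤y = subst₂ _≤ℝ_ (+-comm x z) (+-comm y z) (+-mono z x≤y)

  +-mono-≤ : ∀ {a b c d} → a ≤ℝ b → c ≤ℝ d → a + c ≤ℝ b + d
  +-mono-≤ {b = b} {c} a≤b c≤d = ≤-trans (+-mono c a≤b) (+-monoʳ-≤ b c≤d)

  x≤y⇒0≤y-x : ∀ {x y} → x ≤ℝ y → 0ℝ ≤ℝ y + - x
  x≤y⇒0≤y-x {x} {y} x≤y = subst (_≤ℝ y + - x) (+-invʳ x) (+-mono (- x) x≤y)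

  0≤y-x⇒x≤y : ∀ {x y} → 0ℝ ≤ℝ y + - x → x ≤ℝ y
  0≤y-x⇒x≤y {x} {y} 0≤y-x =
    subst₂ _≤ℝ_ (+-identityˡ x) (solve 2 (λ x y → (y :- x) :+ x := y) refl x y) (+-mono x 0≤y-x)

  neg-antimono-≤ : ∀ {x y} → x ≤ℝ y → - y ≤ℝ - x
  neg-antimono-≤ {x} {y} x≤y =
    0≤y-x⇒x≤y (subst (0ℝ ≤ℝ_) (solve 2 (λ x y → y :- x := :- x :- (:- y)) refl x y) (x≤y⇒0≤y-x x≤y))

  0≤x⇒-x≤0 : ∀ {x} → 0ℝ ≤ℝ x → - x ≤ℝ 0ℝ
  0≤x⇒-x≤0 0≤x = subst (_ ≤ℝ_) -0#≈0# (neg-antimono-≤ 0≤x)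

  x≤0⇒0≤-x : ∀ {x} → x ≤ℝ 0ℝ → 0ℝ ≤ℝ - x
  x≤0⇒0≤-x x≤0 = subst (_≤ℝ _) -0#≈0# (neg-antimono-≤ x≤0)

  *-monoʳ-≤ : ∀ c {a b} → 0ℝ ≤ℝ c → a ≤ℝ b → c * a ≤ℝ c * b
  *-monoʳ-≤ c {a} {b} 0≤c a≤b = 0≤y-x⇒x≤y (subst (0ℝ ≤ℝ_)
    (solve 3 (λ c a b → c :* (b :- a) := c :* b :- c :* a) refl c a b)
    (*-nonneg 0≤c (x≤y⇒0≤y-x a≤b)))

  *-monoˡ-≤ : ∀ c {a b} → 0ℝ ≤ℝ c → a ≤ℝ b → a * c ≤ℝ b * c
  *-monoˡ-≤ c {a} {b} 0≤c a≤b = subst₂ _≤ℝ_ (*-comm c a) (*-comm c b) (*-monoʳ-≤ c 0≤c a≤b)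

  *-antimonoʳ-≤ : ∀ c {a b} → c ≤ℝ 0ℝ → a ≤ℝ b → c * b ≤ℝ c * a
  *-antimonoʳ-≤ c {a} {b} c≤0 a≤b =
    subst₂ _≤ℝ_ (-‿neg c b) (-‿neg c a) (neg-antimono-≤ (*-monoʳ-≤ (- c) (x≤0⇒0≤-x c≤0) a≤b))
    where -‿neg : ∀ c t → - (- c * t) ≡ c * t
          -‿neg c t = solve 2 (λ c t → :- (:- c :* t) := c :* t) refl c t

  a+b+c≤a+c⇒b≤0 : ∀ {a b c} → a + b + c ≤ℝ a + c → b ≤ℝ 0ℝ
  a+b+c≤a+c⇒b≤0 {a} {b} {c} a+b+c≤a+c = subst₂ _≤ℝ_ (-‿involutive b) -0#≈0# (neg-antimono-≤ (subst (0ℝ ≤ℝ_)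
    (solve 3 (λ a b c → a :+ c :- (a :+ b :+ c) := :- b) refl a b c) (x≤y⇒0≤y-x a+b+c≤a+c)))

  0≤1 : 0ℝ ≤ℝ 1ℝ
  0≤1 with ≤-total 0ℝ 1ℝ
  ... | inj₁ 0≤1 = 0≤1
  ... | inj₂ 1≤0 = subst (0ℝ ≤ℝ_) square (*-nonneg (x≤0⇒0≤-x 1≤0) (x≤0⇒0≤-x 1≤0))
    where square : - 1ℝ * - 1ℝ ≡ 1ℝ
          square = trans (solve 1 (λ x → :- x :* :- x := x :* x) refl 1ℝ) (*-idʳ 1ℝ)

  1≰0 : ¬ (1ℝ ≤ℝ 0ℝ)
  1≰0 1≤0 = 0≢1 (≤-antisym 0≤1 1≤0)

  fromℕ-nonneg : ∀ n → 0ℝ ≤ℝ fromℕ n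
  fromℕ-nonneg zero    = ≤-refl 0ℝ
  fromℕ-nonneg (suc n) = subst (_≤ℝ fromℕ (suc n)) (+-idʳ 0ℝ) (+-mono-≤ 0≤1 (fromℕ-nonneg n))

  fromℕ-mono-≤ : ∀ {m n} → m ≤ n → fromℕ m ≤ℝ fromℕ n
  fromℕ-mono-≤ {m} {n} m≤n = begin
    fromℕ m                    ≡⟨ +-idʳ (fromℕ m) ⟨
    fromℕ m + 0ℝ               ≤⟨ +-monoʳ-≤ (fromℕ m) (fromℕ-nonneg (n ℕ.∸ m)) ⟩
    fromℕ m + fromℕ (n ℕ.∸ m)  ≡⟨ fromℕ-+ m (n ℕ.∸ m) ⟨
    fromℕ (m ℕ.+ (n ℕ.∸ m))    ≡⟨ cong fromℕ (ℕ.m+[n∸m]≡n m≤n) ⟩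
    fromℕ n                    ∎
    where open ≤-Reasoning

  fromℕ-suc-≰0 : ∀ n → ¬ (fromℕ (suc n) ≤ℝ 0ℝ)
  fromℕ-suc-≰0 n 1+n≤0 = 1≰0 (≤-trans 1≤1+n 1+n≤0)
    where 1≤1+n = subst (_≤ℝ fromℕ (suc n)) (+-idʳ 1ℝ) (+-monoʳ-≤ 1ℝ (fromℕ-nonneg n))

  fromℕ-suc≢0 : ∀ n → fromℕ (suc n) ≢ 0ℝ
  fromℕ-suc≢0 n 1+n≡0 = fromℕ-suc-≰0 n (≤-reflexive 1+n≡0)

  1/[1+_] : ℕ → ℝ
  1/[1+ n ] = proj₁ (*-invʳ (fromℕ (suc n)) (fromℕ-suc≢0 n))

  [1+n]*1/[1+n]≡1 : ∀ n → fromℕ (suc n) * 1/[1+ n ] ≡ 1ℝ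
  [1+n]*1/[1+n]≡1 n = proj₂ (*-invʳ (fromℕ (suc n)) (fromℕ-suc≢0 n))

  1/[1+n]-nonneg : ∀ n → 0ℝ ≤ℝ 1/[1+ n ]
  1/[1+n]-nonneg n with ≤-total 0ℝ 1/[1+ n ]
  ... | inj₁ 0≤1/[1+n] = 0≤1/[1+n]
  ... | inj₂ 1/[1+n]≤0 = ⊥-elim (1≰0 (subst₂ _≤ℝ_ ([1+n]*1/[1+n]≡1 n) (zeroʳ _)
                           (*-monoʳ-≤ (fromℕ (suc n)) (fromℕ-nonneg (suc n)) 1/[1+n]≤0)))

  [1+n]*[t/[1+n]]≡t : ∀ n t → fromℕ (suc n) * (t * 1/[1+ n ]) ≡ t
  [1+n]*[t/[1+n]]≡t n t = begin
    fromℕ (suc n) * (t * 1/[1+ n ])  ≡⟨ solve 3 (λ a t b → a :* (t :* b) := a :* b :* t) refl (fromℕ (suc n)) t 1/[1+ n ] ⟩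
    fromℕ (suc n) * 1/[1+ n ] * t    ≡⟨ cong (_* t) ([1+n]*1/[1+n]≡1 n) ⟩
    1ℝ * t                           ≡⟨ *-identityˡ t ⟩
    t                                ∎
    where open ≡-Reasoning

  x≤t/[1+n]⇒[1+n]x≤t : ∀ n {x t} → x ≤ℝ t * 1/[1+ n ] → fromℕ (suc n) * x ≤ℝ t
  x≤t/[1+n]⇒[1+n]x≤t n {x} {t} x≤t/[1+n] =
    subst (_ ≤ℝ_) ([1+n]*[t/[1+n]]≡t n t) (*-monoʳ-≤ (fromℕ (suc n)) (fromℕ-nonneg (suc n)) x≤t/[1+n])

  t/[1+n]≤x⇒t≤[1+n]x : ∀ n {x t} → t * 1/[1+ n ] ≤ℝ x → t ≤ℝ fromℕ (suc n) * x
  t/[1+n]≤x⇒t≤[1+n]x n {x} {t} t/[1+n]≤x =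
    subst (_≤ℝ _) ([1+n]*[t/[1+n]]≡t n t) (*-monoʳ-≤ (fromℕ (suc n)) (fromℕ-nonneg (suc n)) t/[1+n]≤x)

  cross-≤ : ∀ c d {u v} → fromℕ (suc c) * u ≤ℝ fromℕ (suc d) * v → u * 1/[1+ d ] ≤ℝ v * 1/[1+ c ]
  cross-≤ c d {u} {v} cu≤dv = begin
    u * 1/[1+ d ]                      ≡⟨ *-identityˡ _ ⟨
    1ℝ * (u * 1/[1+ d ])               ≡⟨ cong (_* (u * 1/[1+ d ])) ([1+n]*1/[1+n]≡1 c) ⟨
    C * 1/[1+ c ] * (u * 1/[1+ d ])    ≡⟨ solve 4 (λ C c⁻¹ u d⁻¹ → C :* c⁻¹ :* (u :* d⁻¹) := C :* u :* (c⁻¹ :* d⁻¹)) refl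
                                            C 1/[1+ c ] u 1/[1+ d ] ⟩
    C * u * (1/[1+ c ] * 1/[1+ d ])    ≤⟨ *-monoˡ-≤ _ (*-nonneg (1/[1+n]-nonneg c) (1/[1+n]-nonneg d)) cu≤dv ⟩
    D * v * (1/[1+ c ] * 1/[1+ d ])    ≡⟨ solve 4 (λ D v c⁻¹ d⁻¹ → D :* v :* (c⁻¹ :* d⁻¹) := D :* d⁻¹ :* (v :* c⁻¹)) refl
                                            D v 1/[1+ c ] 1/[1+ d ] ⟩
    D * 1/[1+ d ] * (v * 1/[1+ c ])    ≡⟨ cong (_* (v * 1/[1+ c ])) ([1+n]*1/[1+n]≡1 d) ⟩
    1ℝ * (v * 1/[1+ c ])               ≡⟨ *-identityˡ _ ⟩
    v * 1/[1+ c ]                      ∎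
    where
      open ≤-Reasoning
      C = fromℕ (suc c)
      D = fromℕ (suc d)

  lowerBound-exists : (us : List ℝ) → ∃[ x ] All (x ≤ℝ_) us
  lowerBound-exists []       = 0ℝ , []
  lowerBound-exists (u ∷ us) with lowerBound-exists us
  ... | x , x≤us with ≤-total u x
  ...   | inj₁ u≤x = u , ≤-refl u ∷ All.map (≤-trans u≤x) x≤us
  ...   | inj₂ x≤u = x , x≤u ∷ x≤us

  sandwich : (ls us : List ℝ) → All (λ l → All (l ≤ℝ_) us) ls → ∃[ x ] All (_≤ℝ x) ls × All (x ≤ℝ_) us
  sandwich []       us _ = let x , x≤us = lowerBound-exists us in x , [] , x≤us
  sandwich (l ∷ ls) us (l≤us ∷ ls≤us) with sandwich ls us ls≤us
  ... | x , ls≤x , x≤us with ≤-total l x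
  ...   | inj₁ l≤x = x , l≤x ∷ ls≤x , x≤us
  ...   | inj₂ x≤l = l , ≤-refl l ∷ All.map (λ l'≤x → ≤-trans l'≤x x≤l) ls≤x , l≤us

module Sums (R : RealField) where
  open RealField R
  open OrderedField R

  sumFin-cong : ∀ n {f g : Fin n → ℝ} → (∀ i → f i ≡ g i) → sumFin R n f ≡ sumFin R n g
  sumFin-cong zero    f≗g = refl
  sumFin-cong (suc n) f≗g = cong₂ _+_ (f≗g zero) (sumFin-cong n (f≗g ∘ suc))

  sumFin-zero : ∀ n {f : Fin n → ℝ} → (∀ i → f i ≡ 0ℝ) → sumFin R n f ≡ 0ℝ
  sumFin-zero zero    f≗0 = refl
  sumFin-zero (suc n) f≗0 = trans (cong₂ _+_ (f≗0 zero) (sumFin-zero n (f≗0 ∘ suc))) (+-idʳ 0ℝ)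

  sumIn-⊥ : ∀ {n} (x : Fin n → ℝ) → sumIn R ⊥ x ≡ 0ℝ
  sumIn-⊥ {n} x = sumFin-zero n (λ i → cong (if_then x i else 0ℝ) (lookup-⊥ i))

  sumFin-*ˡ : ∀ n c (f : Fin n → ℝ) → sumFin R n (λ i → c * f i) ≡ c * sumFin R n f
  sumFin-*ˡ zero    c f = sym (zeroʳ c)
  sumFin-*ˡ (suc n) c f = trans (cong (c * f zero +_) (sumFin-*ˡ n c (f ∘ suc))) (sym (distribˡ _ _ _))

  sumFin-neg : ∀ n (f : Fin n → ℝ) → sumFin R n (λ i → - f i) ≡ - sumFin R n f
  sumFin-neg zero    f = sym -0#≈0#
  sumFin-neg (suc n) f = trans (cong (- f zero +_) (sumFin-neg n (f ∘ suc))) (-‿+-comm _ _)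

  sumFin-mono-≤ : ∀ n {f g : Fin n → ℝ} → (∀ i → f i ≤ℝ g i) → sumFin R n f ≤ℝ sumFin R n g
  sumFin-mono-≤ zero    f≤g = ≤-refl 0ℝ
  sumFin-mono-≤ (suc n) f≤g = +-mono-≤ (f≤g zero) (sumFin-mono-≤ n (f≤g ∘ suc))

  sumSub-cong : ∀ n {f g : Subset n → ℝ} → (∀ S → f S ≡ g S) → sumSub R n f ≡ sumSub R n g
  sumSub-cong zero    f≗g = f≗g []
  sumSub-cong (suc n) f≗g = cong₂ _+_ (sumSub-cong n (f≗g ∘ (false ∷_))) (sumSub-cong n (f≗g ∘ (true ∷_)))

  sumSub-zero : ∀ n {f : Subset n → ℝ} → (∀ S → f S ≡ 0ℝ) → sumSub R n f ≡ 0ℝ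
  sumSub-zero zero    f≗0 = f≗0 []
  sumSub-zero (suc n) f≗0 =
    trans (cong₂ _+_ (sumSub-zero n (f≗0 ∘ (false ∷_))) (sumSub-zero n (f≗0 ∘ (true ∷_)))) (+-idʳ 0ℝ)

  sumSub-+ : ∀ n (f g : Subset n → ℝ) → sumSub R n (λ S → f S + g S) ≡ sumSub R n f + sumSub R n g
  sumSub-+ zero    f g = refl
  sumSub-+ (suc n) f g = trans (cong₂ _+_ (sumSub-+ n _ _) (sumSub-+ n _ _)) (solve 4 (λ a b c d → (a :+ b) :+ (c :+ d) := (a :+ c) :+ (b :+ d)) refl _ _ _ _)

  sumSub-*ˡ : ∀ n c (f : Subset n → ℝ) → sumSub R n (λ S → c * f S) ≡ c * sumSub R n f
  sumSub-*ˡ zero    c f = refl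
  sumSub-*ˡ (suc n) c f = trans (cong₂ _+_ (sumSub-*ˡ n c _) (sumSub-*ˡ n c _)) (sym (distribˡ _ _ _))

  sumSub-neg : ∀ n (f : Subset n → ℝ) → sumSub R n (λ S → - f S) ≡ - sumSub R n f
  sumSub-neg zero    f = refl
  sumSub-neg (suc n) f = trans (cong₂ _+_ (sumSub-neg n _) (sumSub-neg n _)) (-‿+-comm _ _)

  sumSub-mono-≤ : ∀ n {f g : Subset n → ℝ} → (∀ S → f S ≤ℝ g S) → sumSub R n f ≤ℝ sumSub R n g
  sumSub-mono-≤ zero    f≤g = f≤g []
  sumSub-mono-≤ (suc n) f≤g = +-mono-≤ (sumSub-mono-≤ n (f≤g ∘ (false ∷_))) (sumSub-mono-≤ n (f≤g ∘ (true ∷_)))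

  sumSub-sumFin : ∀ n k (f : Subset n → Fin k → ℝ) →
                  sumSub R n (λ S → sumFin R k (f S)) ≡ sumFin R k (λ i → sumSub R n (λ S → f S i))
  sumSub-sumFin n zero    f = sumSub-zero n (λ S → refl)
  sumSub-sumFin n (suc k) f = trans (sumSub-+ n _ _) (cong (sumSub R n (λ S → f S zero) +_) (sumSub-sumFin n k (λ S i → f S (suc i))))

  at : ∀ {n} → Subset n → ℝ → Subset n → ℝ
  at X c S = if does (X ≟ₛ S) then c else 0ℝ

  at-≢ : ∀ {n} {X S : Subset n} c → X ≢ S → at X c S ≡ 0ℝ
  at-≢ {X = X} {S} c X≢S = cong (if_then c else 0ℝ) (dec-false (X ≟ₛ S) X≢S)

  at-self : ∀ {n} (X : Subset n) c → at X c X ≡ c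
  at-self X c = cong (if_then c else 0ℝ) (dec-true (X ≟ₛ X) refl)

  sumSub-at : ∀ n X (h : Subset n → ℝ) → sumSub R n (λ S → at X (h S) S) ≡ h X
  sumSub-at zero    []          h = refl
  sumSub-at (suc n) (false ∷ X) h =
    trans (cong₂ _+_ (sumSub-at n X (h ∘ (false ∷_))) (sumSub-zero n (λ S → refl))) (+-idʳ _)
  sumSub-at (suc n) (true ∷ X)  h =
    trans (cong₂ _+_ (sumSub-zero n (λ S → refl)) (sumSub-at n X (h ∘ (true ∷_)))) (+-identityˡ _)

  at-*ʳ : ∀ {n} (X S : Subset n) c y → at X c S * y ≡ at X (c * y) S
  at-*ʳ X S c y with X ≟ₛ S
  ... | yes _ = refl
  ... | no  _ = zeroˡ y

  sumSub-concentrated : ∀ n X (h : Subset n → ℝ) → (∀ S → S ≢ X → h S ≡ 0ℝ) → sumSub R n h ≡ h X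
  sumSub-concentrated n X h h≡0 = trans (sumSub-cong n concentrate) (sumSub-at n X h)
    where concentrate : ∀ S → h S ≡ at X (h S) S
          concentrate S with X ≟ₛ S
          ... | yes _   = refl
          ... | no  X≢S = h≡0 S (X≢S ∘ sym)

  fromℕ-sumSubℕ : ∀ n (f : Subset n → ℕ) → fromℕ (sumSubℕ n f) ≡ sumSub R n (fromℕ ∘ f)
  fromℕ-sumSubℕ zero    f = refl
  fromℕ-sumSubℕ (suc n) f = trans (fromℕ-+ (sumSubℕ n (f ∘ (false ∷_))) _)
    (cong₂ _+_ (fromℕ-sumSubℕ n (f ∘ (false ∷_))) (fromℕ-sumSubℕ n (f ∘ (true ∷_))))

  module _ {n} (i : Fin n) where

    sumSubWith-+ : ∀ (f g : Subset n → ℝ) → sumSubWith R i (λ S → f S + g S) ≡ sumSubWith R i f + sumSubWith R i g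
    sumSubWith-+ f g = trans (sumSub-cong n (λ S → split (lookup S i) (f S) (g S))) (sumSub-+ n _ _)
      where split : ∀ b x y → (if b then x + y else 0ℝ) ≡ (if b then x else 0ℝ) + (if b then y else 0ℝ)
            split true  x y = refl
            split false x y = sym (+-idʳ 0ℝ)

    sumSubWith-*ˡ : ∀ c (f : Subset n → ℝ) → sumSubWith R i (λ S → c * f S) ≡ c * sumSubWith R i f
    sumSubWith-*ˡ c f = trans (sumSub-cong n (λ S → split (lookup S i) (f S))) (sumSub-*ˡ n c _)
      where split : ∀ b x → (if b then c * x else 0ℝ) ≡ c * (if b then x else 0ℝ)
            split true  x = refl
            split false x = sym (zeroʳ c)

    sumSubWith-neg : ∀ (f : Subset n → ℝ) → sumSubWith R i (λ S → - f S) ≡ - sumSubWith R i f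
    sumSubWith-neg f = trans (sumSub-cong n (λ S → split (lookup S i) (f S))) (sumSub-neg n _)
      where split : ∀ b x → (if b then - x else 0ℝ) ≡ - (if b then x else 0ℝ)
            split true  x = refl
            split false x = sym -0#≈0#

    sumSubWith-at : ∀ X c → sumSubWith R i (at X c) ≡ (if lookup X i then c else 0ℝ)
    sumSubWith-at X c = trans (sumSub-cong n swap) (sumSub-at n X (λ S → if lookup S i then c else 0ℝ))
      where swap : ∀ S → (if lookup S i then at X c S else 0ℝ) ≡ at X (if lookup S i then c else 0ℝ) S
            swap S with X ≟ₛ S | lookup S i
            ... | yes _ | _     = refl
            ... | no  _ | true  = refl
            ... | no  _ | false = refl

module FourierMotzkin (R : RealField) where
  open RealField R
  open OrderedField R
  open Sums R

  record Inequality (k : ℕ) : Set where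
    field
      coeff : Fin k → ℤ
      bound : ℝ
  open Inequality public

  head : ∀ {k} → Inequality (suc k) → ℤ
  head r = coeff r zero

  tail : ∀ {k} → Inequality (suc k) → Inequality k
  tail r = record { coeff = coeff r ∘ suc ; bound = bound r }

  lhs : ∀ {k} → Inequality k → (Fin k → ℝ) → ℝ
  lhs {k} r x = sumFin R k (λ j → fromℤ (coeff r j) * x j)

  infix 4 _⊨_
  _⊨_ : ∀ {k} → (Fin k → ℝ) → Inequality k → Set
  x ⊨ r = lhs r x ≤ℝ bound r

  combine : ∀ {k} → ℕ → Inequality k → ℕ → Inequality k → Inequality k
  combine p r q s = record
    { coeff = λ j → ℤ.+ p ℤ.* coeff r j ℤ.+ ℤ.+ q ℤ.* coeff s j
    ; bound = fromℕ p * bound r + fromℕ q * bound s }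

  fromℤ-combine : ∀ p q a b → fromℤ (ℤ.+ p ℤ.* a ℤ.+ ℤ.+ q ℤ.* b) ≡ fromℕ p * fromℤ a + fromℕ q * fromℤ b
  fromℤ-combine p q a b = trans (fromℤ-+ (ℤ.+ p ℤ.* a) (ℤ.+ q ℤ.* b)) (cong₂ _+_ (fromℤ-* (ℤ.+ p) a) (fromℤ-* (ℤ.+ q) b))

  lhs-combine : ∀ {k} p q (r s : Inequality k) x → lhs (combine p r q s) x ≡ fromℕ p * lhs r x + fromℕ q * lhs s x
  lhs-combine {zero}  p q r s x = sym (trans (cong₂ _+_ (zeroʳ _) (zeroʳ _)) (+-idʳ 0ℝ))
  lhs-combine {suc k} p q r s x = begin
    fromℤ (ℤ.+ p ℤ.* coeff r zero ℤ.+ ℤ.+ q ℤ.* coeff s zero) * x zero + lhs (combine p (tail r) q (tail s)) (x ∘ suc)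
      ≡⟨ cong₂ (λ a b → a * x zero + b) (fromℤ-combine p q (coeff r zero) (coeff s zero)) (lhs-combine p q (tail r) (tail s) (x ∘ suc)) ⟩
    (P * fromℤ (coeff r zero) + Q * fromℤ (coeff s zero)) * x zero + (P * lhs (tail r) (x ∘ suc) + Q * lhs (tail s) (x ∘ suc))
      ≡⟨ solve 7 (λ P Q a b x u v → (P :* a :+ Q :* b) :* x :+ (P :* u :+ Q :* v) := P :* (a :* x :+ u) :+ Q :* (b :* x :+ v)) refl
           P Q (fromℤ (coeff r zero)) (fromℤ (coeff s zero)) (x zero) (lhs (tail r) (x ∘ suc)) (lhs (tail s) (x ∘ suc)) ⟩
    P * lhs r x + Q * lhs s x ∎
    where
      open ≡-Reasoning
      P = fromℕ p
      Q = fromℕ q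

  Cone : ∀ {k} → (Inequality k → Set) → Set
  Cone C = ∀ p q r s → C r → C s → C (combine p r q s)

  Consistent : ∀ {k} → (Inequality k → Set) → Set
  Consistent C = ∀ r → C r → (∀ j → coeff r j ≡ +0) → 0ℝ ≤ℝ bound r

  module _ {k : ℕ} where

    keepIfZero : ℤ → Inequality (suc k) → List (Inequality k)
    keepIfZero +0 r = tail r ∷ []
    keepIfZero _  r = []

    cancelHeads : ℤ → ℤ → Inequality (suc k) → Inequality (suc k) → List (Inequality k)
    cancelHeads +[1+ c ] -[1+ d ] r s = tail (combine (suc d) r (suc c) s) ∷ []
    cancelHeads _        _        r s = []

    eliminate : List (Inequality (suc k)) → List (Inequality k)
    eliminate rs = concatMap (λ r → keepIfZero (head r) r) rs
                ++ concatMap (λ r → concatMap (λ s → cancelHeads (head r) (head s) r s) rs) rs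

  module Elimination {k} (C : Inequality (suc k) → Set) (cone : Cone C) (consistent : Consistent C) where

    Projection : Inequality k → Set
    Projection r′ = ∃[ r ] C r × head r ≡ +0 × (∀ j → coeff r (suc j) ≡ coeff r′ j) × bound r ≡ bound r′

    projection-cone : Cone Projection
    projection-cone p q r′ s′ (r , Cr , r₀ , r≈ , r-bound) (s , Cs , s₀ , s≈ , s-bound) =
      combine p r q s , cone p q r s Cr Cs ,
      trans (cong₂ mix r₀ s₀) (cong₂ ℤ._+_ (ℤ.*-zeroʳ (ℤ.+ p)) (ℤ.*-zeroʳ (ℤ.+ q))) ,
      (λ j → cong₂ mix (r≈ j) (s≈ j)) ,
      cong₂ (λ a b → fromℕ p * a + fromℕ q * b) r-bound s-bound
      where mix = λ a b → ℤ.+ p ℤ.* a ℤ.+ ℤ.+ q ℤ.* b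

    projection-consistent : Consistent Projection
    projection-consistent r′ (r , Cr , r₀ , r≈ , r-bound) r′≡0 = subst (0ℝ ≤ℝ_) r-bound (consistent r Cr r≡0)
      where
        r≡0 : ∀ j → coeff r j ≡ +0
        r≡0 zero    = r₀
        r≡0 (suc j) = trans (r≈ j) (r′≡0 j)

    keepIfZero-projection : ∀ h r → head r ≡ h → C r → All Projection (keepIfZero h r)
    keepIfZero-projection +0        r r₀ Cr = (r , Cr , r₀ , (λ j → refl) , refl) ∷ []
    keepIfZero-projection +[1+ _ ] r _  _  = []
    keepIfZero-projection -[1+ _ ] r _  _  = []

    cancelHeads-projection : ∀ h₁ h₂ r s → head r ≡ h₁ → head s ≡ h₂ → C r → C s →
                             All Projection (cancelHeads h₁ h₂ r s)
    cancelHeads-projection +[1+ c ] -[1+ d ] r s r₀ s₀ Cr Cs =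
      (combine (suc d) r (suc c) s , cone (suc d) (suc c) r s Cr Cs ,
       trans (cong₂ (λ a b → +[1+ d ] ℤ.* a ℤ.+ +[1+ c ] ℤ.* b) r₀ s₀) heads-cancel ,
       (λ j → refl) , refl) ∷ []
      where
        heads-cancel : +[1+ d ] ℤ.* +[1+ c ] ℤ.+ +[1+ c ] ℤ.* -[1+ d ] ≡ +0
        heads-cancel = trans (cong₂ ℤ._+_ (ℤ.*-comm +[1+ d ] +[1+ c ]) (sym (ℤ.neg-distribʳ-* +[1+ c ] +[1+ d ])))
                             (ℤ.+-inverseʳ (+[1+ c ] ℤ.* +[1+ d ]))
    cancelHeads-projection +0        _        r s _ _ _ _ = []
    cancelHeads-projection -[1+ _ ] _        r s _ _ _ _ = []
    cancelHeads-projection +[1+ _ ] +0       r s _ _ _ _ = []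
    cancelHeads-projection +[1+ _ ] +[1+ _ ] r s _ _ _ _ = []

    eliminate-projection : ∀ rs → All C rs → All Projection (eliminate rs)
    eliminate-projection rs Crs = All.++⁺
      (All.concat⁺ (All.map⁺ (All.map (λ {r} Cr → keepIfZero-projection (head r) r refl Cr) Crs)))
      (All.concat⁺ (All.map⁺ (All.map (λ {r} Cr → All.concat⁺ (All.map⁺ (All.map (λ {s} Cs →
        cancelHeads-projection (head r) (head s) r s refl refl Cr Cs) Crs))) Crs)))

  module BackSubstitution {k} (x′ : Fin k → ℝ) where

    rest : Inequality (suc k) → ℝ
    rest r = lhs (tail r) x′

    lowerBounds : ℤ → Inequality (suc k) → List ℝ
    lowerBounds -[1+ d ] r = (rest r + - bound r) * 1/[1+ d ] ∷ []
    lowerBounds _        r = []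

    upperBounds : ℤ → Inequality (suc k) → List ℝ
    upperBounds +[1+ c ] r = (bound r + - rest r) * 1/[1+ c ] ∷ []
    upperBounds _        r = []

    lower≤upper : ∀ h₁ h₂ r s → All (x′ ⊨_) (cancelHeads h₁ h₂ r s) →
                  All (λ l → All (l ≤ℝ_) (upperBounds h₁ r)) (lowerBounds h₂ s)
    lower≤upper +[1+ c ] -[1+ d ] r s (x′⊨rs ∷ []) = (cross-≤ c d Cs≤Dr ∷ []) ∷ []
      where
        C = fromℕ (suc c)
        D = fromℕ (suc d)
        Cs≤Dr : C * (rest s + - bound s) ≤ℝ D * (bound r + - rest r)
        Cs≤Dr = 0≤y-x⇒x≤y (subst (0ℝ ≤ℝ_)
          (solve 6 (λ C D a b u v → D :* a :+ C :* b :- (D :* u :+ C :* v) := D :* (a :- u) :- C :* (v :- b)) refl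
             C D (bound r) (bound s) (rest r) (rest s))
          (x≤y⇒0≤y-x (subst (_≤ℝ _) (lhs-combine (suc d) (suc c) (tail r) (tail s) x′) x′⊨rs)))
    lower≤upper +0        -[1+ _ ] r s _ = [] ∷ []
    lower≤upper -[1+ _ ] -[1+ _ ] r s _ = [] ∷ []
    lower≤upper _         +0        r s _ = []
    lower≤upper _         +[1+ _ ] r s _ = []

    ⊨-extend : ∀ h r x₀ → head r ≡ h → All (x′ ⊨_) (keepIfZero h r) →
               All (x₀ ≤ℝ_) (upperBounds h r) → All (_≤ℝ x₀) (lowerBounds h r) → (x₀ Vecᶠ.∷ x′) ⊨ r
    ⊨-extend h r x₀ refl = extend h
      where
        extend : ∀ h → All (x′ ⊨_) (keepIfZero h r) → All (x₀ ≤ℝ_) (upperBounds h r) →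
                 All (_≤ℝ x₀) (lowerBounds h r) → fromℤ h * x₀ + rest r ≤ℝ bound r
        extend +0 (x′⊨r ∷ []) _ _ = subst (_≤ℝ bound r) (sym (trans (cong (_+ rest r) (zeroˡ x₀)) (+-identityˡ _))) x′⊨r
        extend +[1+ c ] _ (x₀≤u ∷ []) _ =
          subst (fromℕ (suc c) * x₀ + rest r ≤ℝ_) (solve 2 (λ b u → b :- u :+ u := b) refl (bound r) (rest r))
                (+-mono (rest r) (x≤t/[1+n]⇒[1+n]x≤t c x₀≤u))
        extend -[1+ d ] _ _ (l≤x₀ ∷ []) = 0≤y-x⇒x≤y (subst (0ℝ ≤ℝ_)
          (solve 4 (λ D x u b → D :* x :- (u :- b) := b :- (:- D :* x :+ u)) refl (fromℕ (suc d)) x₀ (rest r) (bound r))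
          (x≤y⇒0≤y-x (t/[1+n]≤x⇒t≤[1+n]x d l≤x₀)))

  feasible : ∀ k (C : Inequality k → Set) → Cone C → Consistent C →
             (rs : List (Inequality k)) → All C rs → ∃[ x ] All (x ⊨_) rs
  feasible zero    C _    consistent rs Crs = (λ ()) , All.map (λ {r} Cr → consistent r Cr (λ ())) Crs
  feasible (suc k) C cone consistent rs Crs = x₀ Vecᶠ.∷ x′ , All.tabulate x⊨r
    where
      open Elimination C cone consistent
      solution = feasible k Projection projection-cone projection-consistent (eliminate rs) (eliminate-projection rs Crs)
      x′ = proj₁ solution
      open BackSubstitution x′

      kept : All (λ r → All (x′ ⊨_) (keepIfZero (head r) r)) rs
      kept = All.map⁻ (All.concat⁻ (All.++⁻ˡ _ (proj₂ solution)))

      cancelled : All (λ r → All (λ s → All (x′ ⊨_) (cancelHeads (head r) (head s) r s)) rs) rs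
      cancelled = All.map (λ h → All.map⁻ (All.concat⁻ h)) (All.map⁻ (All.concat⁻ (All.++⁻ʳ _ (proj₂ solution))))

      ls = concatMap (λ r → lowerBounds (head r) r) rs
      us = concatMap (λ r → upperBounds (head r) r) rs

      ls≤us : All (λ l → All (l ≤ℝ_) us) ls
      ls≤us = All.concat⁺ (All.map⁺ (All.tabulate λ {s} s∈rs → All.tabulate λ l∈ →
        All.concat⁺ (All.map⁺ (All.tabulate λ {r} r∈rs →
          All.lookup (lower≤upper (head r) (head s) r s (All.lookup (All.lookup cancelled r∈rs) s∈rs)) l∈))))

      sandwiched = sandwich ls us ls≤us
      x₀ = proj₁ sandwiched

      x⊨r : ∀ {r} → r ∈ₗ rs → (x₀ Vecᶠ.∷ x′) ⊨ r
      x⊨r {r} r∈rs = ⊨-extend (head r) r x₀ refl (All.lookup kept r∈rs)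
        (All.lookup (All.map⁻ (All.concat⁻ (proj₂ (proj₂ sandwiched)))) r∈rs)
        (All.lookup (All.map⁻ (All.concat⁻ (proj₁ (proj₂ sandwiched)))) r∈rs)

module Forward (R : RealField) where
  open RealField R
  open OrderedField R
  open Sums R

  module _ {n} (θ : Subset n → ℝ) where

    pairing-tilde : sumSub R n θ ≡ 0ℝ → ∀ m → ⟨_,_⟩ R θ m ≡ ⟨_,_⟩ R θ (tilde R m)
    pairing-tilde Σθ≡0 m = begin
      sumSub R n (λ S → θ S * m S)                                          ≡⟨ +-idʳ _ ⟨
      sumSub R n (λ S → θ S * m S) + 0ℝ                                     ≡⟨ cong (sumSub R n (λ S → θ S * m S) +_) Σθm⊥≡0 ⟨
      sumSub R n (λ S → θ S * m S) + sumSub R n (λ S → θ S * - m ⊥)         ≡⟨ sumSub-+ n _ _ ⟨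
      sumSub R n (λ S → θ S * m S + θ S * - m ⊥)                            ≡⟨ sumSub-cong n (λ S → distribˡ (θ S) _ _) ⟨
      sumSub R n (λ S → θ S * tilde R m S)                                  ∎
      where
        open ≡-Reasoning
        Σθm⊥≡0 : sumSub R n (λ S → θ S * - m ⊥) ≡ 0ℝ
        Σθm⊥≡0 = begin
          sumSub R n (λ S → θ S * - m ⊥)    ≡⟨ sumSub-cong n (λ S → *-comm (θ S) _) ⟩
          sumSub R n (λ S → - m ⊥ * θ S)    ≡⟨ sumSub-*ˡ n (- m ⊥) θ ⟩
          - m ⊥ * sumSub R n θ              ≡⟨ cong (- m ⊥ *_) Σθ≡0 ⟩
          - m ⊥ * 0ℝ                        ≡⟨ zeroʳ _ ⟩
          0ℝ                                ∎

    pairing-additive : (∀ i → sumSubWith R i θ ≡ 0ℝ) → ∀ x → ⟨_,_⟩ R θ (λ S → sumIn R S x) ≡ 0ℝ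
    pairing-additive Σθ∋i≡0 x = begin
      sumSub R n (λ S → θ S * sumFin R n (λ i → [ S ∋ i ] x i))
        ≡⟨ sumSub-cong n (λ S → sumFin-*ˡ n (θ S) _) ⟨
      sumSub R n (λ S → sumFin R n (λ i → θ S * [ S ∋ i ] x i))
        ≡⟨ sumSub-sumFin n n _ ⟩
      sumFin R n (λ i → sumSub R n (λ S → θ S * [ S ∋ i ] x i))
        ≡⟨ sumFin-cong n (λ i → trans (sumSub-cong n (λ S → swap (lookup S i) (θ S) (x i))) (sumSub-*ˡ n (x i) _)) ⟩
      sumFin R n (λ i → x i * sumSubWith R i θ)
        ≡⟨ sumFin-zero n (λ i → trans (cong (x i *_) (Σθ∋i≡0 i)) (zeroʳ (x i))) ⟩
      0ℝ ∎
      where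
        open ≡-Reasoning
        [_∋_]_ : Subset n → Fin n → ℝ → ℝ
        [ S ∋ i ] a = if lookup S i then a else 0ℝ
        swap : ∀ b a y → a * (if b then y else 0ℝ) ≡ y * (if b then a else 0ℝ)
        swap true  a y = *-comm a y
        swap false a y = trans (zeroʳ a) (sym (zeroʳ y))

  core-pointwise : ∀ {n} {M : Subset n} {θ g : Subset n → ℝ} {x : Fin n → ℝ} → InΔM R M θ → g ⊥ ≡ 0ℝ →
                   sumIn R M x ≡ g M → (∀ S → S ⊆ M → g S ≤ℝ sumIn R S x) →
                   ∀ S → θ S * sumIn R S x ≤ℝ θ S * g S
  core-pointwise {M = M} {θ} {g} {x} (θ≤0 , θ-outside , _) g⊥≡0 xM≡gM g≤x S with S ⊆? M
  ... | no S⊈M = ≤-reflexive (trans (cong (_* sumIn R S x) θS≡0) (trans (zeroˡ _) (sym (trans (cong (_* g S) θS≡0) (zeroˡ _)))))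
    where θS≡0 = θ-outside S S⊈M
  ... | yes S⊆M with nonempty? S
  ...   | no S-empty = ≤-reflexive (cong (θ S *_) (begin
          sumIn R S x  ≡⟨ cong (λ T → sumIn R T x) (Empty-unique S-empty) ⟩
          sumIn R ⊥ x  ≡⟨ sumIn-⊥ x ⟩
          0ℝ           ≡⟨ g⊥≡0 ⟨
          g ⊥          ≡⟨ cong g (Empty-unique S-empty) ⟨
          g S          ∎))
    where open ≡-Reasoning
  ...   | yes S-nonempty with S ⊂? M
  ...     | yes S⊂M = *-antimonoʳ-≤ (θ S) (θ≤0 S S-nonempty S⊂M) (g≤x S S⊆M)
  ...     | no  S⊄M = ≤-reflexive (cong (θ S *_) (trans (cong (λ T → sumIn R T x) S≡M) (trans xM≡gM (cong g (sym S≡M)))))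
    where S≡M = ⊆∧⊄⇒≡ S⊆M S⊄M

  ΔM-pairing-nonneg : ∀ {n} {M : Subset n} {θ} → InΔM R M θ → ∀ m → CoreNonempty R (tilde R m) M → 0ℝ ≤ℝ ⟨_,_⟩ R θ m
  ΔM-pairing-nonneg {n} {M} {θ} θ∈ΔM@(_ , _ , _ , Σθ≡0 , Σθ∋i≡0) m (x , xM≡gM , g≤x) = begin
    0ℝ                                  ≡⟨ pairing-additive θ Σθ∋i≡0 x ⟨
    ⟨_,_⟩ R θ (λ S → sumIn R S x)       ≤⟨ sumSub-mono-≤ n (core-pointwise θ∈ΔM (+-invʳ (m ⊥)) xM≡gM g≤x) ⟩
    ⟨_,_⟩ R θ (tilde R m)               ≡⟨ pairing-tilde θ Σθ≡0 m ⟨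
    ⟨_,_⟩ R θ m                         ∎
    where open ≤-Reasoning

  pairing-convex : ∀ {n} k (w : Fin k → ℝ) (p : Fin k → Subset n → ℝ) θ →
                   (∀ S → θ S ≡ sumFin R k (λ j → w j * p j S)) →
                   ∀ m → ⟨_,_⟩ R θ m ≡ sumFin R k (λ j → w j * ⟨_,_⟩ R (p j) m)
  pairing-convex {n} k w p θ θ≡Σwp m = begin
    sumSub R n (λ S → θ S * m S)
      ≡⟨ sumSub-cong n (λ S → trans (cong (_* m S) (θ≡Σwp S)) (trans (*-comm _ (m S)) (sym (sumFin-*ˡ k (m S) _)))) ⟩
    sumSub R n (λ S → sumFin R k (λ j → m S * (w j * p j S)))
      ≡⟨ sumSub-sumFin n k _ ⟩
    sumFin R k (λ j → sumSub R n (λ S → m S * (w j * p j S)))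
      ≡⟨ sumFin-cong k (λ j → trans (sumSub-cong n (λ S → solve 3 (λ m w p → m :* (w :* p) := w :* (p :* m)) refl (m S) (w j) (p j S)))
                                    (sumSub-*ˡ n (w j) _)) ⟩
    sumFin R k (λ j → w j * ⟨_,_⟩ R (p j) m) ∎
    where open ≡-Reasoning

  T⇒Δ-nonneg : ∀ {n} (m : Subset n → ℝ) → InT R m → ∀ θ → InΔ R θ → 0ℝ ≤ℝ ⟨_,_⟩ R θ m
  T⇒Δ-nonneg m m∈T θ (k , w , M , p , w≥0 , _ , 2≤∣M∣ , p∈ΔM , θ≡Σwp) = begin
    0ℝ                                         ≡⟨ sumFin-zero k (λ _ → refl) ⟨
    sumFin R k (λ _ → 0ℝ)                      ≤⟨ sumFin-mono-≤ k weighted-nonneg ⟩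
    sumFin R k (λ j → w j * ⟨_,_⟩ R (p j) m)   ≡⟨ pairing-convex k w p θ θ≡Σwp m ⟨
    ⟨_,_⟩ R θ m                                ∎
    where
      open ≤-Reasoning
      weighted-nonneg : ∀ j → 0ℝ ≤ℝ w j * ⟨_,_⟩ R (p j) m
      weighted-nonneg j = subst (_≤ℝ w j * ⟨_,_⟩ R (p j) m) (zeroʳ (w j)) (*-monoʳ-≤ (w j) (w≥0 j)
        (ΔM-pairing-nonneg (p∈ΔM j) m (m∈T (M j) (2≤∣S∣⇒nonempty (2≤∣M∣ j)))))

module Backward (R : RealField) {n : ℕ} (m : Subset n → RealField.ℝ R) (A : Subset n) where
  open RealField R
  open OrderedField R
  open Sums R
  open FourierMotzkin R

  g : Subset n → ℝ
  g = tilde R m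

  𝟙 : Subset n → Fin n → ℝ
  𝟙 S j = if lookup S j then 1ℝ else 0ℝ

  coverage : (Subset n → ℕ) → Fin n → ℝ
  coverage β j = sumSubWith R j (fromℕ ∘ β)

  worth : (Subset n → ℕ) → ℝ
  worth β = sumSub R n (λ S → fromℕ (β S) * g S)

  efficiency : Inequality n
  efficiency = record { coeff = λ j → if lookup A j then ℤ.1ℤ else +0 ; bound = g A }

  rationality : Subset n → Inequality n
  rationality S = record { coeff = λ j → if lookup S j then ℤ.-1ℤ else +0 ; bound = - g S }

  coreSystem : List (Inequality n)
  coreSystem = efficiency ∷ map rationality (filter (_⊆? A) (subsets n))

  -- r = μ · efficiency + Σ_S β(S) · rationality S, with β supported on subsets of A.
  Generated : Inequality n → Set
  Generated r = ∃[ β ] ∃[ μ ] (∀ S → ¬ S ⊆ A → β S ≡ 0)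
              × (∀ j → fromℤ (coeff r j) + coverage β j ≡ fromℕ μ * 𝟙 A j)
              × bound r ≡ fromℕ μ * g A + - worth β

  lhs-efficiency : ∀ x → lhs efficiency x ≡ sumIn R A x
  lhs-efficiency x = sumFin-cong n (λ j → unit (lookup A j) (x j))
    where unit : ∀ b y → fromℤ (if b then ℤ.1ℤ else +0) * y ≡ (if b then y else 0ℝ)
          unit true  y = trans (cong (_* y) fromℕ-1) (*-identityˡ y)
          unit false y = zeroˡ y

  lhs-rationality : ∀ S x → lhs (rationality S) x ≡ - sumIn R S x
  lhs-rationality S x = trans (sumFin-cong n (λ j → unit (lookup S j) (x j))) (sumFin-neg n _)
    where unit : ∀ b y → fromℤ (if b then ℤ.-1ℤ else +0) * y ≡ - (if b then y else 0ℝ)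
          unit true  y = trans (sym (-‿distribˡ-* _ y)) (cong -_ (trans (cong (_* y) fromℕ-1) (*-identityˡ y)))
          unit false y = trans (zeroˡ y) (sym -0#≈0#)

  efficiency-generated : Generated efficiency
  efficiency-generated = (λ _ → 0) , 1 , (λ _ _ → refl) , coeff-eq , bound-eq
    where
      coeff-eq : ∀ j → fromℤ (coeff efficiency j) + coverage (λ _ → 0) j ≡ fromℕ 1 * 𝟙 A j
      coeff-eq j = trans (cong (fromℤ (coeff efficiency j) +_) (sumSub-zero n (λ S → if-same (lookup S j))))
                         (trans (+-idʳ _) (unit (lookup A j)))
        where
          if-same : ∀ b → (if b then 0ℝ else 0ℝ) ≡ 0ℝ
          if-same true  = refl
          if-same false = refl
          unit : ∀ b → fromℤ (if b then ℤ.1ℤ else +0) ≡ fromℕ 1 * (if b then 1ℝ else 0ℝ)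
          unit true  = sym (*-idʳ _)
          unit false = sym (zeroʳ _)
      bound-eq : g A ≡ fromℕ 1 * g A + - worth (λ _ → 0)
      bound-eq = sym (begin
        fromℕ 1 * g A + - worth (λ _ → 0)  ≡⟨ cong (λ w → fromℕ 1 * g A + - w) (sumSub-zero n (λ S → zeroˡ (g S))) ⟩
        fromℕ 1 * g A + - 0ℝ               ≡⟨ cong₂ (λ a z → a * g A + z) fromℕ-1 -0#≈0# ⟩
        1ℝ * g A + 0ℝ                      ≡⟨ trans (+-idʳ _) (*-identityˡ _) ⟩
        g A                                ∎)
        where open ≡-Reasoning

  rationality-generated : ∀ S → S ⊆ A → Generated (rationality S)
  rationality-generated S S⊆A = δ , 0 , supp , coeff-eq , bound-eq
    where
      δ : Subset n → ℕ
      δ T = if does (S ≟ₛ T) then 1 else 0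
      fromℕ-δ : ∀ T → fromℕ (δ T) ≡ at S (fromℕ 1) T
      fromℕ-δ T with S ≟ₛ T
      ... | yes _ = refl
      ... | no  _ = refl
      supp : ∀ T → ¬ T ⊆ A → δ T ≡ 0
      supp T T⊈A with S ≟ₛ T
      ... | yes refl = ⊥-elim (T⊈A S⊆A)
      ... | no  _    = refl
      coverage-δ : ∀ j → coverage δ j ≡ (if lookup S j then fromℕ 1 else 0ℝ)
      coverage-δ j = trans (sumSub-cong n (λ T → cong (if lookup T j then_else 0ℝ) (fromℕ-δ T))) (sumSubWith-at j S (fromℕ 1))
      coeff-eq : ∀ j → fromℤ (coeff (rationality S) j) + coverage δ j ≡ fromℕ 0 * 𝟙 A j
      coeff-eq j = trans (cong (fromℤ (coeff (rationality S) j) +_) (coverage-δ j)) (trans (cancel (lookup S j)) (sym (zeroˡ _)))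
        where cancel : ∀ b → fromℤ (if b then ℤ.-1ℤ else +0) + (if b then fromℕ 1 else 0ℝ) ≡ 0ℝ
              cancel true  = -‿inverseˡ _
              cancel false = +-idʳ 0ℝ
      bound-eq : - g S ≡ fromℕ 0 * g A + - worth δ
      bound-eq = sym (begin
        fromℕ 0 * g A + - worth δ                           ≡⟨ cong (_+ - worth δ) (zeroˡ (g A)) ⟩
        0ℝ + - worth δ                                      ≡⟨ +-identityˡ _ ⟩
        - sumSub R n (λ T → fromℕ (δ T) * g T)              ≡⟨ cong -_ (sumSub-cong n (λ T → trans (cong (_* g T) (fromℕ-δ T)) (at-*ʳ S T _ (g T)))) ⟩
        - sumSub R n (λ T → at S (fromℕ 1 * g T) T)         ≡⟨ cong -_ (sumSub-at n S (λ T → fromℕ 1 * g T)) ⟩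
        - (fromℕ 1 * g S)                                   ≡⟨ cong -_ (trans (cong (_* g S) fromℕ-1) (*-identityˡ _)) ⟩
        - g S                                               ∎)
        where open ≡-Reasoning

  coreSystem-generated : All Generated coreSystem
  coreSystem-generated = efficiency-generated ∷ All.map⁺ (All.map (λ {S} → rationality-generated S) (All.all-filter (_⊆? A) (subsets n)))

  generated-cone : Cone Generated
  generated-cone p q r s (β₁ , μ₁ , supp₁ , coeff₁ , bound₁) (β₂ , μ₂ , supp₂ , coeff₂ , bound₂) =
    β , μ , supp , coeff-eq , bound-eq
    where
      P = fromℕ p
      Q = fromℕ q
      β : Subset n → ℕ
      β S = p ℕ.* β₁ S ℕ.+ q ℕ.* β₂ S
      μ = p ℕ.* μ₁ ℕ.+ q ℕ.* μ₂

      fromℕ-mix : ∀ a b → fromℕ (p ℕ.* a ℕ.+ q ℕ.* b) ≡ P * fromℕ a + Q * fromℕ b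
      fromℕ-mix a b = trans (fromℕ-+ (p ℕ.* a) (q ℕ.* b)) (cong₂ _+_ (fromℕ-* p a) (fromℕ-* q b))

      supp : ∀ S → ¬ S ⊆ A → β S ≡ 0
      supp S S⊈A rewrite supp₁ S S⊈A | supp₂ S S⊈A = cong₂ ℕ._+_ (ℕ.*-zeroʳ p) (ℕ.*-zeroʳ q)

      coverage-mix : ∀ j → coverage β j ≡ P * coverage β₁ j + Q * coverage β₂ j
      coverage-mix j = begin
        coverage β j
          ≡⟨ sumSub-cong n (λ S → cong (if lookup S j then_else 0ℝ) (fromℕ-mix (β₁ S) (β₂ S))) ⟩
        sumSubWith R j (λ S → P * fromℕ (β₁ S) + Q * fromℕ (β₂ S))
          ≡⟨ sumSubWith-+ j _ _ ⟩
        sumSubWith R j (λ S → P * fromℕ (β₁ S)) + sumSubWith R j (λ S → Q * fromℕ (β₂ S))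
          ≡⟨ cong₂ _+_ (sumSubWith-*ˡ j P _) (sumSubWith-*ˡ j Q _) ⟩
        P * coverage β₁ j + Q * coverage β₂ j ∎
        where open ≡-Reasoning

      worth-mix : worth β ≡ P * worth β₁ + Q * worth β₂
      worth-mix = trans (sumSub-cong n distribute) (trans (sumSub-+ n _ _) (cong₂ _+_ (sumSub-*ˡ n P _) (sumSub-*ˡ n Q _)))
        where distribute : ∀ S → fromℕ (β S) * g S ≡ P * (fromℕ (β₁ S) * g S) + Q * (fromℕ (β₂ S) * g S)
              distribute S = trans (cong (_* g S) (fromℕ-mix (β₁ S) (β₂ S)))
                (solve 5 (λ P Q a b x → (P :* a :+ Q :* b) :* x := P :* (a :* x) :+ Q :* (b :* x)) refl P Q (fromℕ (β₁ S)) (fromℕ (β₂ S)) (g S))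

      coeff-eq : ∀ j → fromℤ (ℤ.+ p ℤ.* coeff r j ℤ.+ ℤ.+ q ℤ.* coeff s j) + coverage β j ≡ fromℕ μ * 𝟙 A j
      coeff-eq j = begin
        fromℤ (ℤ.+ p ℤ.* a₁ ℤ.+ ℤ.+ q ℤ.* a₂) + coverage β j
          ≡⟨ cong₂ _+_ (fromℤ-combine p q a₁ a₂) (coverage-mix j) ⟩
        (P * fromℤ a₁ + Q * fromℤ a₂) + (P * coverage β₁ j + Q * coverage β₂ j)
          ≡⟨ solve 6 (λ P Q a b u v → (P :* a :+ Q :* b) :+ (P :* u :+ Q :* v) := P :* (a :+ u) :+ Q :* (b :+ v)) refl
               P Q (fromℤ a₁) (fromℤ a₂) (coverage β₁ j) (coverage β₂ j) ⟩
        P * (fromℤ a₁ + coverage β₁ j) + Q * (fromℤ a₂ + coverage β₂ j)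
          ≡⟨ cong₂ (λ u v → P * u + Q * v) (coeff₁ j) (coeff₂ j) ⟩
        P * (fromℕ μ₁ * 𝟙 A j) + Q * (fromℕ μ₂ * 𝟙 A j)
          ≡⟨ solve 5 (λ P Q a b x → P :* (a :* x) :+ Q :* (b :* x) := (P :* a :+ Q :* b) :* x) refl P Q (fromℕ μ₁) (fromℕ μ₂) (𝟙 A j) ⟩
        (P * fromℕ μ₁ + Q * fromℕ μ₂) * 𝟙 A j
          ≡⟨ cong (_* 𝟙 A j) (fromℕ-mix μ₁ μ₂) ⟨
        fromℕ μ * 𝟙 A j ∎
        where
          open ≡-Reasoning
          a₁ = coeff r j
          a₂ = coeff s j

      bound-eq : P * bound r + Q * bound s ≡ fromℕ μ * g A + - worth β
      bound-eq = begin
        P * bound r + Q * bound s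
          ≡⟨ cong₂ (λ u v → P * u + Q * v) bound₁ bound₂ ⟩
        P * (fromℕ μ₁ * g A + - worth β₁) + Q * (fromℕ μ₂ * g A + - worth β₂)
          ≡⟨ solve 7 (λ P Q a b x u v → P :* (a :* x :- u) :+ Q :* (b :* x :- v) := (P :* a :+ Q :* b) :* x :- (P :* u :+ Q :* v)) refl
               P Q (fromℕ μ₁) (fromℕ μ₂) (g A) (worth β₁) (worth β₂) ⟩
        (P * fromℕ μ₁ + Q * fromℕ μ₂) * g A + - (P * worth β₁ + Q * worth β₂)
          ≡⟨ cong₂ (λ a w → a * g A + - w) (fromℕ-mix μ₁ μ₂) worth-mix ⟨
        fromℕ μ * g A + - worth β ∎
        where open ≡-Reasoning

  module Balanced (β : Subset n → ℕ) (μ : ℕ) (supp : ∀ S → ¬ S ⊆ A → β S ≡ 0)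
                  (balanced : ∀ j → coverage β j ≡ fromℕ μ * 𝟙 A j) where

    surplus : ℝ
    surplus = fromℕ μ * g A + - worth β

    coverage-∈A : ∀ {j} → j ∈ A → coverage β j ≡ fromℕ μ
    coverage-∈A {j} j∈A =
      trans (balanced j) (trans (cong (λ b → fromℕ μ * (if b then 1ℝ else 0ℝ)) (Vec.[]=⇒lookup j∈A)) (*-idʳ _))

    Trivial : Set
    Trivial = ∀ S → S ≢ ⊥ → S ≢ A → β S ≡ 0

    trivial⇒surplus≡0 : Nonempty A → Trivial → surplus ≡ 0ℝ
    trivial⇒surplus≡0 (j , j∈A) trivial = begin
      fromℕ μ * g A + - worth β                   ≡⟨ cong₂ (λ a w → a * g A + - w) μ≡βA worth≡ ⟩
      fromℕ (β A) * g A + - (fromℕ (β A) * g A)   ≡⟨ +-invʳ _ ⟩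
      0ℝ                                          ∎
      where
        open ≡-Reasoning
        worth≡ : worth β ≡ fromℕ (β A) * g A
        worth≡ = sumSub-concentrated n A _ off-A
          where off-A : ∀ S → S ≢ A → fromℕ (β S) * g S ≡ 0ℝ
                off-A S S≢A with S ≟ₛ ⊥
                ... | yes refl = trans (cong (fromℕ (β ⊥) *_) (+-invʳ (m ⊥))) (zeroʳ _)
                ... | no  S≢⊥  = trans (cong (λ b → fromℕ b * g S) (trivial S S≢⊥ S≢A)) (zeroˡ _)
        μ≡βA : fromℕ μ ≡ fromℕ (β A)
        μ≡βA = begin
          fromℕ μ         ≡⟨ coverage-∈A j∈A ⟨
          coverage β j    ≡⟨ sumSub-concentrated n A _ off-A ⟩
          (if lookup A j then fromℕ (β A) else 0ℝ) ≡⟨ cong (if_then fromℕ (β A) else 0ℝ) (Vec.[]=⇒lookup j∈A) ⟩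
          fromℕ (β A)     ∎
          where off-A : ∀ S → S ≢ A → (if lookup S j then fromℕ (β S) else 0ℝ) ≡ 0ℝ
                off-A S S≢A with S ≟ₛ ⊥
                ... | yes refl = cong (if_then fromℕ (β ⊥) else 0ℝ) (lookup-⊥ j)
                ... | no  S≢⊥  with β S | trivial S S≢⊥ S≢A | lookup S j
                ...   | .0 | refl | true  = refl
                ...   | .0 | refl | false = refl

    small⇒trivial : ¬ 2 ≤ ∣ A ∣ → Trivial
    small⇒trivial small S S≢⊥ S≢A with S ⊆? A
    ... | no  S⊈A = supp S S⊈A
    ... | yes S⊆A with S ⊂? A
    ...   | yes S⊂A = ⊥-elim (small (ℕ.≤-trans (ℕ.s≤s (nonempty⇒1≤∣S∣ (≢⊥⇒nonempty S≢⊥))) (p⊂q⇒∣p∣<∣q∣ S⊂A)))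
    ...   | no  S⊄A = ⊥-elim (S≢A (⊆∧⊄⇒≡ S⊆A S⊄A))

    -- ⊥, S and the coalitions containing j are pairwise distinct when j ∉ S ≢ ⊥.
    β⊥+βS+coverage≤total : ∀ {S j} → S ≢ ⊥ → j ∉ S → fromℕ (β ⊥) + fromℕ (β S) + coverage β j ≤ℝ fromℕ (sumSubℕ n β)
    β⊥+βS+coverage≤total {S} {j} S≢⊥ j∉S = begin
      fromℕ (β ⊥) + fromℕ (β S) + coverage β j
        ≡⟨ cong₂ (λ a b → a + b + coverage β j) (sumSub-at n ⊥ (fromℕ ∘ β)) (sumSub-at n S (fromℕ ∘ β)) ⟨
      sumSub R n (λ U → at ⊥ (fromℕ (β U)) U) + sumSub R n (λ U → at S (fromℕ (β U)) U) + coverage β j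
        ≡⟨ trans (sumSub-+ n _ _) (cong (_+ coverage β j) (sumSub-+ n _ _)) ⟨
      sumSub R n (λ U → at ⊥ (fromℕ (β U)) U + at S (fromℕ (β U)) U + (if lookup U j then fromℕ (β U) else 0ℝ))
        ≤⟨ sumSub-mono-≤ n pointwise ⟩
      sumSub R n (fromℕ ∘ β)
        ≡⟨ fromℕ-sumSubℕ n β ⟨
      fromℕ (sumSubℕ n β) ∎
      where
        open ≤-Reasoning
        pointwise : ∀ U → (if does (⊥ ≟ₛ U) then fromℕ (β U) else 0ℝ) + (if does (S ≟ₛ U) then fromℕ (β U) else 0ℝ)
                          + (if lookup U j then fromℕ (β U) else 0ℝ) ≤ℝ fromℕ (β U)
        pointwise U with ⊥ ≟ₛ U | S ≟ₛ U | lookup U j in j∈?U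
        ... | yes refl | yes refl | _     = ⊥-elim (S≢⊥ refl)
        ... | yes refl | no  _    | true  with () ← trans (sym (lookup-⊥ j)) j∈?U
        ... | yes refl | no  _    | false = ≤-reflexive (trans (+-idʳ _) (+-idʳ _))
        ... | no  _    | yes refl | true  = ⊥-elim (j∉S (Vec.lookup⇒[]= j S j∈?U))
        ... | no  _    | yes refl | false = ≤-reflexive (trans (+-idʳ _) (+-identityˡ _))
        ... | no  _    | no  _    | true  = ≤-reflexive (trans (cong (_+ fromℕ (β U)) (+-idʳ 0ℝ)) (+-identityˡ _))
        ... | no  _    | no  _    | false = subst (_≤ℝ fromℕ (β U)) (sym (trans (+-idʳ _) (+-idʳ 0ℝ))) (fromℕ-nonneg (β U))

    light⇒trivial : sumSubℕ n β ≤ β ⊥ ℕ.+ μ → Trivial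
    light⇒trivial light S S≢⊥ S≢A with S ⊆? A
    ... | no  S⊈A = supp S S⊈A
    ... | yes S⊆A with S ⊂? A
    ...   | no  S⊄A = ⊥-elim (S≢A (⊆∧⊄⇒≡ S⊆A S⊄A))
    ...   | yes (_ , j , j∈A , j∉S) with β S in βS≡
    ...     | zero  = refl
    ...     | suc l = ⊥-elim (fromℕ-suc-≰0 l (a+b+c≤a+c⇒b≤0 (begin
      fromℕ (β ⊥) + fromℕ (suc l) + fromℕ μ      ≡⟨ cong₂ (λ b c → fromℕ (β ⊥) + fromℕ b + c) βS≡ (coverage-∈A j∈A) ⟨
      fromℕ (β ⊥) + fromℕ (β S) + coverage β j  ≤⟨ β⊥+βS+coverage≤total S≢⊥ j∉S ⟩
      fromℕ (sumSubℕ n β)                        ≤⟨ fromℕ-mono-≤ light ⟩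
      fromℕ (β ⊥ ℕ.+ μ)                          ≡⟨ fromℕ-+ (β ⊥) μ ⟩
      fromℕ (β ⊥) + fromℕ μ                      ∎)))
      where open ≤-Reasoning

    module Heavy (t : ℕ) (total≡ : sumSubℕ n β ≡ β ⊥ ℕ.+ μ ℕ.+ suc t) (A-large : 2 ≤ ∣ A ∣) (A≢⊥ : A ≢ ⊥) where

      c : ℝ
      c = fromℕ (suc t) + fromℕ (β ⊥)

      -- c is chosen so that θ′ sums to zero; then θ′(⊥) = 1 + t > 0 can be normalised to 1.
      θ′ : Subset n → ℝ
      θ′ S = at ⊥ c S + at A (fromℕ μ) S + - fromℕ (β S)

      θ : Subset n → ℝ
      θ S = 1/[1+ t ] * θ′ S

      Σβ≡ : sumSub R n (fromℕ ∘ β) ≡ fromℕ (β ⊥) + fromℕ μ + fromℕ (suc t)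
      Σβ≡ = begin
        sumSub R n (fromℕ ∘ β)                  ≡⟨ fromℕ-sumSubℕ n β ⟨
        fromℕ (sumSubℕ n β)                     ≡⟨ cong fromℕ total≡ ⟩
        fromℕ (β ⊥ ℕ.+ μ ℕ.+ suc t)             ≡⟨ fromℕ-+ (β ⊥ ℕ.+ μ) (suc t) ⟩
        fromℕ (β ⊥ ℕ.+ μ) + fromℕ (suc t)       ≡⟨ cong (_+ fromℕ (suc t)) (fromℕ-+ (β ⊥) μ) ⟩
        fromℕ (β ⊥) + fromℕ μ + fromℕ (suc t)   ∎
        where open ≡-Reasoning

      θ′-generic : ∀ {S} → ⊥ ≢ S → A ≢ S → θ′ S ≡ - fromℕ (β S)
      θ′-generic {S} ⊥≢S A≢S =
        trans (cong₂ (λ a b → a + b + - fromℕ (β S)) (at-≢ c ⊥≢S) (at-≢ (fromℕ μ) A≢S))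
              (trans (cong (_+ - fromℕ (β S)) (+-idʳ 0ℝ)) (+-identityˡ _))

      θ′-⊥ : θ′ ⊥ ≡ fromℕ (suc t)
      θ′-⊥ = begin
        θ′ ⊥                                            ≡⟨ cong₂ (λ a b → a + b + - fromℕ (β ⊥)) (at-self (⊥ {n}) c) (at-≢ (fromℕ μ) A≢⊥) ⟩
        c + 0ℝ + - fromℕ (β ⊥)                          ≡⟨ cong (_+ - fromℕ (β ⊥)) (+-idʳ c) ⟩
        fromℕ (suc t) + fromℕ (β ⊥) + - fromℕ (β ⊥)     ≡⟨ solve 2 (λ x y → x :+ y :- y := x) refl (fromℕ (suc t)) (fromℕ (β ⊥)) ⟩
        fromℕ (suc t)                                   ∎
        where open ≡-Reasoning

      Σθ′≡0 : sumSub R n θ′ ≡ 0ℝ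
      Σθ′≡0 = begin
        sumSub R n θ′
          ≡⟨ trans (sumSub-+ n _ _) (cong₂ _+_ (sumSub-+ n _ _) (sumSub-neg n _)) ⟩
        sumSub R n (at ⊥ c) + sumSub R n (at A (fromℕ μ)) + - sumSub R n (fromℕ ∘ β)
          ≡⟨ cong₂ (λ a b → a + b + - sumSub R n (fromℕ ∘ β)) (sumSub-at n ⊥ (λ _ → c)) (sumSub-at n A (λ _ → fromℕ μ)) ⟩
        c + fromℕ μ + - sumSub R n (fromℕ ∘ β)
          ≡⟨ cong (λ x → c + fromℕ μ + - x) Σβ≡ ⟩
        fromℕ (suc t) + fromℕ (β ⊥) + fromℕ μ + - (fromℕ (β ⊥) + fromℕ μ + fromℕ (suc t))
          ≡⟨ solve 3 (λ x y z → x :+ y :+ z :- (y :+ z :+ x) := con (ℤ.+ 0)) refl (fromℕ (suc t)) (fromℕ (β ⊥)) (fromℕ μ) ⟩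
        0ℝ ∎
        where open ≡-Reasoning

      Σ∋θ′≡0 : ∀ i → sumSubWith R i θ′ ≡ 0ℝ
      Σ∋θ′≡0 i = begin
        sumSubWith R i θ′
          ≡⟨ trans (sumSubWith-+ i _ _) (cong₂ _+_ (sumSubWith-+ i _ _) (sumSubWith-neg i _)) ⟩
        sumSubWith R i (at ⊥ c) + sumSubWith R i (at A (fromℕ μ)) + - coverage β i
          ≡⟨ cong₂ (λ a b → a + b + - coverage β i) (sumSubWith-at i ⊥ c) (sumSubWith-at i A (fromℕ μ)) ⟩
        (if lookup ⊥ i then c else 0ℝ) + (if lookup A i then fromℕ μ else 0ℝ) + - coverage β i
          ≡⟨ cong₂ (λ a b → a + b + - coverage β i) (cong (if_then c else 0ℝ) (lookup-⊥ i)) (trans (μ𝟙 (lookup A i)) (sym (balanced i))) ⟩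
        0ℝ + coverage β i + - coverage β i
          ≡⟨ trans (cong (_+ - coverage β i) (+-identityˡ _)) (+-invʳ _) ⟩
        0ℝ ∎
        where
          open ≡-Reasoning
          μ𝟙 : ∀ b → (if b then fromℕ μ else 0ℝ) ≡ fromℕ μ * (if b then 1ℝ else 0ℝ)
          μ𝟙 true  = sym (*-idʳ _)
          μ𝟙 false = sym (zeroʳ _)

      θ∈ΔA : InΔM R A θ
      θ∈ΔA = proper-nonpos , outside-zero , θ-⊥ , Σθ≡0 , Σ∋θ≡0
        where
          proper-nonpos : ∀ S → Nonempty S → S ⊂ A → θ S ≤ℝ 0ℝ
          proper-nonpos S S-nonempty S⊂A = subst (θ S ≤ℝ_) (zeroʳ _) (*-monoʳ-≤ 1/[1+ t ] (1/[1+n]-nonneg t)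
            (subst (_≤ℝ 0ℝ) (sym (θ′-generic (nonempty⇒≢⊥ S-nonempty ∘ sym) (λ A≡S → ⊂-irref (sym A≡S) S⊂A)))
                   (0≤x⇒-x≤0 (fromℕ-nonneg (β S)))))
          outside-zero : ∀ S → ¬ S ⊆ A → θ S ≡ 0ℝ
          outside-zero S S⊈A = trans (cong (1/[1+ t ] *_) θ′S≡0) (zeroʳ _)
            where θ′S≡0 = trans (θ′-generic (λ { refl → S⊈A ⊥⊆ }) (λ { refl → S⊈A (λ x∈A → x∈A) }))
                                (trans (cong (λ b → - fromℕ b) (supp S S⊈A)) -0#≈0#)
          θ-⊥ : θ ⊥ ≡ 1ℝ
          θ-⊥ = trans (cong (1/[1+ t ] *_) θ′-⊥) (trans (*-comm _ _) ([1+n]*1/[1+n]≡1 t))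
          Σθ≡0 : sumSub R n θ ≡ 0ℝ
          Σθ≡0 = trans (sumSub-*ˡ n 1/[1+ t ] θ′) (trans (cong (1/[1+ t ] *_) Σθ′≡0) (zeroʳ _))
          Σ∋θ≡0 : ∀ i → sumSubWith R i θ ≡ 0ℝ
          Σ∋θ≡0 i = trans (sumSubWith-*ˡ i 1/[1+ t ] θ′) (trans (cong (1/[1+ t ] *_) (Σ∋θ′≡0 i)) (zeroʳ _))

      θ∈Δ : InΔ R θ
      θ∈Δ = 1 , (λ _ → 1ℝ) , (λ _ → A) , (λ _ → θ) , (λ _ → 0≤1) , +-idʳ 1ℝ , (λ _ → A-large) , (λ _ → θ∈ΔA) ,
            (λ S → sym (trans (+-idʳ _) (*-identityˡ _)))

      pairing-θ′ : ⟨_,_⟩ R θ′ m ≡ surplus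
      pairing-θ′ = begin
        sumSub R n (λ S → θ′ S * m S)
          ≡⟨ sumSub-cong n distribute ⟩
        sumSub R n (λ S → at ⊥ (c * m S) S + at A (fromℕ μ * m S) S + - (fromℕ (β S) * m S))
          ≡⟨ trans (sumSub-+ n _ _) (cong₂ _+_ (trans (sumSub-+ n _ _) (cong₂ _+_ (sumSub-at n ⊥ _) (sumSub-at n A _))) (sumSub-neg n _)) ⟩
        c * m ⊥ + fromℕ μ * m A + - X
          ≡⟨ solve 6 (λ a b u mA m⊥ X → (a :+ b) :* m⊥ :+ u :* mA :- X := u :* (mA :- m⊥) :- (X :- m⊥ :* (b :+ u :+ a))) refl
               (fromℕ (suc t)) (fromℕ (β ⊥)) (fromℕ μ) (m A) (m ⊥) X ⟩
        fromℕ μ * g A + - (X + - (m ⊥ * (fromℕ (β ⊥) + fromℕ μ + fromℕ (suc t))))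
          ≡⟨ cong (λ w → fromℕ μ * g A + - w) worth≡ ⟨
        surplus ∎
        where
          open ≡-Reasoning
          X = sumSub R n (λ S → fromℕ (β S) * m S)
          distribute : ∀ S → θ′ S * m S ≡ at ⊥ (c * m S) S + at A (fromℕ μ * m S) S + - (fromℕ (β S) * m S)
          distribute S = trans (distribʳ (m S) _ _) (cong₂ _+_
            (trans (distribʳ (m S) _ _) (cong₂ _+_ (at-*ʳ ⊥ S c (m S)) (at-*ʳ A S (fromℕ μ) (m S))))
            (sym (-‿distribˡ-* _ (m S))))
          worth≡ : worth β ≡ X + - (m ⊥ * (fromℕ (β ⊥) + fromℕ μ + fromℕ (suc t)))
          worth≡ = begin
            sumSub R n (λ S → fromℕ (β S) * (m S + - m ⊥))
              ≡⟨ sumSub-cong n (λ S → trans (distribˡ _ _ _) (cong (fromℕ (β S) * m S +_)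
                   (trans (sym (-‿distribʳ-* _ _)) (cong -_ (*-comm _ _))))) ⟩
            sumSub R n (λ S → fromℕ (β S) * m S + - (m ⊥ * fromℕ (β S)))
              ≡⟨ trans (sumSub-+ n _ _) (cong (X +_) (trans (sumSub-neg n _) (cong -_ (sumSub-*ˡ n (m ⊥) _)))) ⟩
            X + - (m ⊥ * sumSub R n (fromℕ ∘ β))
              ≡⟨ cong (λ s → X + - (m ⊥ * s)) Σβ≡ ⟩
            X + - (m ⊥ * (fromℕ (β ⊥) + fromℕ μ + fromℕ (suc t))) ∎

      pairing-θ : ⟨_,_⟩ R θ m ≡ 1/[1+ t ] * surplus
      pairing-θ = trans (sumSub-cong n (λ S → *-assoc _ _ _)) (trans (sumSub-*ˡ n 1/[1+ t ] _) (cong (1/[1+ t ] *_) pairing-θ′))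

    surplus-nonneg : Nonempty A → (∀ θ → InΔ R θ → 0ℝ ≤ℝ ⟨_,_⟩ R θ m) → 0ℝ ≤ℝ surplus
    surplus-nonneg A-nonempty Δ-nonneg with 2 ℕ.≤? ∣ A ∣ | sumSubℕ n β ℕ.≤? β ⊥ ℕ.+ μ
    ... | no  small | _        = ≤-reflexive (sym (trivial⇒surplus≡0 A-nonempty (small⇒trivial small)))
    ... | yes _     | yes light = ≤-reflexive (sym (trivial⇒surplus≡0 A-nonempty (light⇒trivial light)))
    ... | yes large | no  heavy with ℕ.m≤n⇒∃[o]m+o≡n (ℕ.≰⇒> heavy)
    ...   | t , 1+β⊥+μ+t≡total = subst (0ℝ ≤ℝ_) (trans (cong (fromℕ (suc t) *_) (*-comm _ _)) ([1+n]*[t/[1+n]]≡t t surplus))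
            (*-nonneg (fromℕ-nonneg (suc t)) (subst (0ℝ ≤ℝ_) pairing-θ (Δ-nonneg θ θ∈Δ)))
      where open Heavy t (trans (sym 1+β⊥+μ+t≡total) (sym (ℕ.+-suc (β ⊥ ℕ.+ μ) t))) large
                       (nonempty⇒≢⊥ A-nonempty)

  generated-consistent : Nonempty A → (∀ θ → InΔ R θ → 0ℝ ≤ℝ ⟨_,_⟩ R θ m) → Consistent Generated
  generated-consistent A-nonempty Δ-nonneg r (β , μ , supp , coeff-eq , bound-eq) r≡0 =
    subst (0ℝ ≤ℝ_) (sym bound-eq) (surplus-nonneg A-nonempty Δ-nonneg)
    where
      balanced : ∀ j → coverage β j ≡ fromℕ μ * 𝟙 A j
      balanced j = trans (sym (+-identityˡ _)) (trans (cong (λ a → fromℤ a + coverage β j) (sym (r≡0 j))) (coeff-eq j))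
      open Balanced β μ supp balanced

Δ-nonneg⇒T : (R : RealField) → ∀ {n} (m : Subset n → RealField.ℝ R) →
      (∀ θ → InΔ R θ → RealField._≤ℝ_ R (RealField.0ℝ R) (⟨_,_⟩ R θ m)) → InT R m
Δ-nonneg⇒T R {n} m Δ-nonneg A A-nonempty = x , ≤-antisym xA≤gA (g≤x A (λ i∈A → i∈A)) , g≤x
  where
    open RealField R
    open OrderedField R
    open FourierMotzkin R
    open Backward R m A
    solution = feasible n Generated generated-cone (generated-consistent A-nonempty Δ-nonneg) coreSystem coreSystem-generated
    x = proj₁ solution
    xA≤gA : sumIn R A x ≤ℝ g A
    xA≤gA = subst (_≤ℝ g A) (lhs-efficiency x) (All.head (proj₂ solution))
    g≤x : ∀ S → S ⊆ A → g S ≤ℝ sumIn R S x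
    g≤x S S⊆A = subst₂ _≤ℝ_ (-‿involutive _) (-‿involutive _) (neg-antimono-≤ (subst (_≤ℝ - g S) (lhs-rationality S x)
      (All.lookup (All.map⁻ (All.tail (proj₂ solution))) (∈-filter⁺ (_⊆? A) (∈-subsets S) S⊆A))))

lemma13 : (R : RealField) → (n : ℕ) → 2 ≤ n → (m : Subset n → RealField.ℝ R) →
    InT R m ⇔ (∀ θ → InΔ R θ → RealField._≤ℝ_ R (RealField.0ℝ R) (⟨_,_⟩ R θ m))
lemma13 R n _ m = mk⇔ (Forward.T⇒Δ-nonneg R m) (Δ-nonneg⇒T R m)
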